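{- Let $q$ be a prime power, $n\ge2$, $0\le h\le n-2$, $k\ge1$. For monic $A\in\mathbb F_q[T]$ of degree $n$ let $\mathcal N^U_{0,\Lambda_k}(A;h)=\sum_{f \text{ monic},\ |f-A|\le q^h,\ f(0)\neq0}\Lambda_k(f)$. Then as $q\to\infty$ (with $n,h,k$ fixed), \[\langle \mathcal{N}^U_{0,\Lambda_k}\rangle:= \frac{1}{q^n} \sum_{A\in \mathcal{M}_n}\mathcal{N}^U_{0,\Lambda_k}(A;h)=\frac{q^{h+1}}{q^n} \sum_{\substack{f\in \mathcal{M}_n\\ f(0)\neq 0}}\Lambda_k(f)=q^{h+1}\binom{n-1}{k-1}+O\left(q^h \right).\]
   Context: $\mathcal M_n$ is the set of monic polynomials of degree $n$ in $\mathbb F_q[T]$; $|g|=q^{\deg g}$ ($|0|=0$). $\Lambda(f)=\deg P$ if $f=P^j$ with $P$ monic irreducible, $j\ge1$, and $0$ otherwise; $\Lambda_k(f)=\sum_{f_1\cdots f_k=f,\ f_i\text{ monic}}\Lambda(f_1)\cdots\Lambda(f_k)$. -}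

module Defs where

open import Data.Nat using (ℕ; zero; suc; _+_; _*_; _∸_; _^_; _≤_; _≤ᵇ_)
open import Data.Nat.Properties using ()
open import Data.Fin using (Fin) renaming (_≟_ to _≟ᶠ_)
open import Data.List using (List; []; _∷_; [_]; map; concatMap; reverse; length; upTo; allFin; _++_)
open import Data.List.Properties using (≡-dec)
open import Data.Nat.ListAction using (sum)
open import Data.Vec using (Vec; toList) renaming ([] to []ᵥ; _∷_ to _∷ᵥ_)
open import Data.Bool using (Bool; true; false; if_then_else_; _∧_; not)
open import Relation.Nullary.Decidable using (does)
open import Relation.Binary.PropositionalEquality using (_≡_)
open import Data.Empty using (⊥)
open import Relation.Nullary using (¬_)
import Algebra.Structures as AS

-- A finite field with q elements, realised on the carrier Fin q
-- (every finite field is isomorphic to one of this form; q is then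
-- automatically a prime power).

record FiniteField : Set where
  field
    q    : ℕ
    _+F_ : Fin q → Fin q → Fin q
    _*F_ : Fin q → Fin q → Fin q
    -F_  : Fin q → Fin q
    0F   : Fin q
    1F   : Fin q
    isCommutativeRing : AS.IsCommutativeRing {A = Fin q} _≡_ _+F_ _*F_ -F_ 0F 1F
    0≢1  : ¬ (0F ≡ 1F)
    inv  : (x : Fin q) → ¬ (x ≡ 0F) → Fin q
    inv-correct : (x : Fin q) (x≢0 : ¬ (x ≡ 0F)) → x *F inv x x≢0 ≡ 1F

Σ[_]_ : {A : Set} → List A → (A → ℕ) → ℕ
Σ[ xs ] f = sum (map f xs)

[_]ᵇ : Bool → ℕ
[ true ]ᵇ  = 1
[ false ]ᵇ = 0

range0 : ℕ → List ℕ
range0 n = upTo (suc n)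

range1 : ℕ → List ℕ
range1 n = map suc (upTo n)

module _ (𝔽 : FiniteField) where
  open FiniteField 𝔽

  Coef : Set
  Coef = Fin q

  -- polynomials in F_q[T] as coefficient lists (constant term first)
  Poly : Set
  Poly = List Coef

  isZeroᶜ : Coef → Bool
  isZeroᶜ x = does (x ≟ᶠ 0F)

  addP : Poly → Poly → Poly
  addP [] ys = ys
  addP (x ∷ xs) [] = x ∷ xs
  addP (x ∷ xs) (y ∷ ys) = (x +F y) ∷ addP xs ys

  negP : Poly → Poly
  negP = map -F_

  subP : Poly → Poly → Poly
  subP xs ys = addP xs (negP ys)

  mulP : Poly → Poly → Poly
  mulP [] ys = []
  mulP (x ∷ xs) ys = addP (map (x *F_) ys) (0F ∷ mulP xs ys)

  oneP : Poly
  oneP = [ 1F ]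

  powP : Poly → ℕ → Poly
  powP p zero = oneP
  powP p (suc j) = mulP p (powP p j)

  dropZeros : List Coef → List Coef
  dropZeros [] = []
  dropZeros (x ∷ xs) = if isZeroᶜ x then dropZeros xs else x ∷ xs

  normalize : Poly → Poly
  normalize p = reverse (dropZeros (reverse p))

  _==P_ : Poly → Poly → Bool
  p ==P r = does (≡-dec _≟ᶠ_ (normalize p) (normalize r))

  absP : Poly → ℕ
  absP p with length (normalize p)
  ... | zero = 0
  ... | suc d = q ^ d

  eval0 : Poly → Coef
  eval0 [] = 0F
  eval0 (x ∷ _) = x

  -- monic polynomials of degree d: the d lower coefficients, leading 1 implicit
  Monic : ℕ → Set
  Monic d = Vec Coef d

  toPoly : {d : ℕ} → Monic d → Poly
  toPoly v = toList v ++ [ 1F ]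

  allVecs : (d : ℕ) → List (Vec Coef d)
  allVecs zero = []ᵥ ∷ []
  allVecs (suc d) = concatMap (λ x → map (x ∷ᵥ_) (allVecs d)) (allFin q)

  𝓜 : (d : ℕ) → List (Monic d)
  𝓜 = allVecs

  irreducibleᵇ : (e : ℕ) → Monic e → Bool
  irreducibleᵇ e P =
    (1 ≤ᵇ e) ∧ does (Data.Nat._≟_
      (Σ[ range1 e ] λ i → Σ[ 𝓜 i ] λ a → Σ[ 𝓜 (e ∸ i) ] λ b →
         [ (1 ≤ᵇ (e ∸ i)) ∧ (mulP (toPoly a) (toPoly b) ==P toPoly P) ]ᵇ)
      0)

  -- von Mangoldt function: Λ(f) = deg P if f = P^j (P monic irreducible,
  -- j ≥ 1), else 0.  Summed over the (unique, if any) pair (P , j).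
  Λ : (d : ℕ) → Monic d → ℕ
  Λ d f = Σ[ range1 d ] λ e → Σ[ 𝓜 e ] λ P → Σ[ range1 d ] λ j →
            [ irreducibleᵇ e P ∧ (powP (toPoly P) j ==P toPoly f) ]ᵇ * e

  -- Λ_k(f) = Σ_{f_1⋯f_k = f, f_i monic} Λ(f_1)⋯Λ(f_k)
  -- (ordered k-tuples; k = 0 gives the empty product, i.e. [f = 1])
  Λ[_] : ℕ → (d : ℕ) → Monic d → ℕ
  Λ[ zero ] d f = [ toPoly f ==P oneP ]ᵇ
  Λ[ suc k ] d f = Σ[ range0 d ] λ e → Σ[ 𝓜 e ] λ g → Σ[ 𝓜 (d ∸ e) ] λ r →
      [ mulP (toPoly g) (toPoly r) ==P toPoly f ]ᵇ * (Λ e g * Λ[ k ] (d ∸ e) r)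

  -- 𝓝^U_{0,Λ_k}(A;h) = Σ_{f monic, |f - A| ≤ q^h, f(0) ≠ 0} Λ_k(f)
  -- (monic f with |f - A| ≤ q^h < q^n = |A| have deg f ≤ n, so the
  -- sum over degrees 0..n exhausts all such f)
  𝓝U : (k n h : ℕ) → Monic n → ℕ
  𝓝U k n h A = Σ[ range0 n ] λ d → Σ[ 𝓜 d ] λ f →
      [ (absP (subP (toPoly f) (toPoly A)) ≤ᵇ q ^ h) ∧ not (isZeroᶜ (eval0 (toPoly f))) ]ᵇ
        * Λ[ k ] d f

  -- Σ_{A ∈ 𝓜_n} 𝓝^U(A;h)   (= q^n ⟨𝓝^U⟩)
  total𝓝U : (k n h : ℕ) → ℕ
  total𝓝U k n h = Σ[ 𝓜 n ] λ A → 𝓝U k n h A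

  SΛ : (k n : ℕ) → ℕ
  SΛ k n = Σ[ 𝓜 n ] λ f → [ not (isZeroᶜ (eval0 (toPoly f))) ]ᵇ * Λ[ k ] n f

{-# OPTIONS --safe #-}
module Submission where

-- The short-interval sum is an average in disguise: for monic f and A of degree n,
-- |f − A| ≤ q^h says that f and A agree in the coefficients of T^(h+1), …, T^(n−1), so
-- every f of degree n is counted for exactly q^(h+1) centres A, while f of smaller
-- degree is never counted.
--
-- For the main term, Σ_{f ∈ 𝓜_n} Λ(f) = q^n (the prime polynomial theorem, obtained by
-- counting Σ_{f ∈ 𝓜_n} deg f = Σ_{P^j ∣ f} deg P in two ways), and Λ_(k+1) = Λ ⋆ Λ_k turns
-- this into Σ_{f ∈ 𝓜_n} Λ_k(f) = C(n−1,k−1) q^n by the hockey-stick identity.  The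
-- terms with f(0) = 0 form the error: such f must have T among its prime factors, and
-- the prime powers with vanishing constant term contribute O(q^(e−1)) in degree e, which
-- propagates through the convolution to O(q^(n−1)).

open import Defs
open import Data.Nat using (ℕ; zero; suc; _+_; _*_; _∸_; _^_; _≤_; _<_; z≤n; s≤s; _≡ᵇ_; _≤ᵇ_; >-nonZero)
import Data.Nat.Properties as ℕₚ
open import Data.Nat.Tactic.RingSolver using (solve-∀)
open import Data.Nat.Combinatorics using (_C_; nCk+nC[k+1]≡[n+1]C[k+1]; k>n⇒nCk≡0)
open import Data.Bool using (Bool; true; false; _∧_; not; if_then_else_)
import Data.Bool
open import Data.Empty using (⊥; ⊥-elim)
open import Data.Fin using (Fin) renaming (zero to fzero; suc to fsuc; _≟_ to _≟ᶠ_)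
import Data.Fin.Properties as Finₚ
open import Data.List using (List; []; _∷_; [_]; map; concatMap; reverse; length; upTo; allFin; tabulate; _++_)
open import Data.List.Properties using (upTo-∷ʳ; length-tabulate; unfold-reverse; reverse-++; ≡-dec)
open import Data.Product using (Σ; Σ-syntax; ∃; _×_; _,_; proj₁; proj₂)
open import Data.Sum using (_⊎_; inj₁; inj₂)
open import Data.Unit using (⊤; tt)
open import Data.Vec using () renaming ([] to []ᵥ; _∷_ to _∷ᵥ_)
import Data.Vec.Properties as Vecₚ
open import Level using (0ℓ)
open import Algebra.Bundles using (CommutativeRing)
import Algebra.Properties.Ring as RingProperties
import Algebra.Properties.CommutativeSemigroup as CommutativeSemigroupProperties
open import Relation.Nullary using (¬_; yes; no; Dec; does)
open import Relation.Nullary.Decidable using (dec-true; dec-false)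
open import Relation.Binary.Definitions using (tri<; tri≈; tri>)
open import Relation.Binary.PropositionalEquality using (_≡_; refl; sym; trans; cong; cong₂; subst; module ≡-Reasoning)

module _ {A : Set} where

  Σ-cong : (xs : List A) {f g : A → ℕ} → (∀ x → f x ≡ g x) → Σ[ xs ] f ≡ Σ[ xs ] g
  Σ-cong []       eq = refl
  Σ-cong (x ∷ xs) eq = cong₂ _+_ (eq x) (Σ-cong xs eq)

  Σ-0 : (xs : List A) → Σ[ xs ] (λ _ → 0) ≡ 0
  Σ-0 []       = refl
  Σ-0 (x ∷ xs) = Σ-0 xs

  Σ-+ : (xs : List A) (f g : A → ℕ) → Σ[ xs ] (λ x → f x + g x) ≡ Σ[ xs ] f + Σ[ xs ] g
  Σ-+ []       f g = refl
  Σ-+ (x ∷ xs) f g = trans (cong (f x + g x +_) (Σ-+ xs f g)) (+-interchange (f x) (g x) _ _)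
    where
    +-interchange : ∀ a b c d → a + b + (c + d) ≡ a + c + (b + d)
    +-interchange = solve-∀

  Σ-*ˡ : (xs : List A) (c : ℕ) (f : A → ℕ) → Σ[ xs ] (λ x → c * f x) ≡ c * Σ[ xs ] f
  Σ-*ˡ []       c f = sym (ℕₚ.*-zeroʳ c)
  Σ-*ˡ (x ∷ xs) c f = trans (cong (c * f x +_) (Σ-*ˡ xs c f)) (sym (ℕₚ.*-distribˡ-+ c (f x) _))

  Σ-*ʳ : (xs : List A) (c : ℕ) (f : A → ℕ) → Σ[ xs ] (λ x → f x * c) ≡ Σ[ xs ] f * c
  Σ-*ʳ xs c f = trans (Σ-cong xs (λ x → ℕₚ.*-comm (f x) c)) (trans (Σ-*ˡ xs c f) (ℕₚ.*-comm c _))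

  Σ-const : (xs : List A) (c : ℕ) → Σ[ xs ] (λ _ → c) ≡ c * length xs
  Σ-const []       c = sym (ℕₚ.*-zeroʳ c)
  Σ-const (x ∷ xs) c = trans (cong (c +_) (Σ-const xs c)) (sym (ℕₚ.*-suc c (length xs)))

  Σ-++ : (xs ys : List A) (f : A → ℕ) → Σ[ xs ++ ys ] f ≡ Σ[ xs ] f + Σ[ ys ] f
  Σ-++ []       ys f = refl
  Σ-++ (x ∷ xs) ys f = trans (cong (f x +_) (Σ-++ xs ys f)) (sym (ℕₚ.+-assoc (f x) _ _))

  Σ-mono-≤ : (xs : List A) {f g : A → ℕ} → (∀ x → f x ≤ g x) → Σ[ xs ] f ≤ Σ[ xs ] g
  Σ-mono-≤ []       le = z≤n
  Σ-mono-≤ (x ∷ xs) le = ℕₚ.+-mono-≤ (le x) (Σ-mono-≤ xs le)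

  Σ≢0⇒∃ : (xs : List A) (f : A → ℕ) → ¬ Σ[ xs ] f ≡ 0 → ∃ λ x → ¬ f x ≡ 0
  Σ≢0⇒∃ []       f ne = ⊥-elim (ne refl)
  Σ≢0⇒∃ (y ∷ xs) f ne with f y ℕₚ.≟ 0
  ... | no fy≢0  = y , fy≢0
  ... | yes fy≡0 = Σ≢0⇒∃ xs f (λ eq → ne (trans (cong (_+ Σ[ xs ] f) fy≡0) eq))

module _ {A B : Set} where

  Σ-map : (xs : List A) (g : A → B) (f : B → ℕ) → Σ[ map g xs ] f ≡ Σ[ xs ] (λ x → f (g x))
  Σ-map []       g f = refl
  Σ-map (x ∷ xs) g f = cong (f (g x) +_) (Σ-map xs g f)

  Σ-concatMap : (xs : List A) (h : A → List B) (f : B → ℕ) →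
    Σ[ concatMap h xs ] f ≡ Σ[ xs ] (λ x → Σ[ h x ] f)
  Σ-concatMap []       h f = refl
  Σ-concatMap (x ∷ xs) h f = trans (Σ-++ (h x) (concatMap h xs) f) (cong (Σ[ h x ] f +_) (Σ-concatMap xs h f))

  Σ-comm : (xs : List A) (ys : List B) (f : A → B → ℕ) →
    Σ[ xs ] (λ x → Σ[ ys ] (f x)) ≡ Σ[ ys ] (λ y → Σ[ xs ] (λ x → f x y))
  Σ-comm []       ys f = sym (Σ-0 ys)
  Σ-comm (x ∷ xs) ys f = trans (cong (Σ[ ys ] (f x) +_) (Σ-comm xs ys f))
    (sym (Σ-+ ys (f x) (λ y → Σ[ xs ] (λ x → f x y))))

Σ-comm-*ˡ : {A B : Set} (xs : List A) (ys : List B) (c : B → ℕ) (h : A → B → ℕ) →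
  Σ[ ys ] (λ y → c y * Σ[ xs ] (λ x → h x y)) ≡ Σ[ xs ] (λ x → Σ[ ys ] (λ y → c y * h x y))
Σ-comm-*ˡ xs ys c h = trans (Σ-cong ys (λ y → sym (Σ-*ˡ xs (c y) (λ x → h x y)))) (Σ-comm ys xs (λ y x → c y * h x y))

sumTo : ℕ → (ℕ → ℕ) → ℕ
sumTo zero    f = 0
sumTo (suc n) f = sumTo n f + f n

Σ-upTo : ∀ n (f : ℕ → ℕ) → Σ[ upTo n ] f ≡ sumTo n f
Σ-upTo zero    f = refl
Σ-upTo (suc n) f = begin
  Σ[ upTo (suc n) ] f       ≡⟨ cong (λ l → Σ[ l ] f) (sym (upTo-∷ʳ n)) ⟩
  Σ[ upTo n ++ [ n ] ] f    ≡⟨ Σ-++ (upTo n) [ n ] f ⟩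
  Σ[ upTo n ] f + (f n + 0) ≡⟨ cong₂ _+_ (Σ-upTo n f) (ℕₚ.+-identityʳ (f n)) ⟩
  sumTo n f + f n           ∎
  where open ≡-Reasoning

Σ-range1 : ∀ n (f : ℕ → ℕ) → Σ[ range1 n ] f ≡ sumTo n (λ i → f (suc i))
Σ-range1 n f = trans (Σ-map (upTo n) suc f) (Σ-upTo n (λ i → f (suc i)))

Σ-range0 : ∀ n (f : ℕ → ℕ) → Σ[ range0 n ] f ≡ sumTo (suc n) f
Σ-range0 n f = Σ-upTo (suc n) f

sumTo-cong : ∀ n {f g : ℕ → ℕ} → (∀ i → i < n → f i ≡ g i) → sumTo n f ≡ sumTo n g
sumTo-cong zero    eq = refl
sumTo-cong (suc n) eq = cong₂ _+_ (sumTo-cong n (λ i i<n → eq i (ℕₚ.m<n⇒m<1+n i<n))) (eq n ℕₚ.≤-refl)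

sumTo-0 : ∀ n {f : ℕ → ℕ} → (∀ i → i < n → f i ≡ 0) → sumTo n f ≡ 0
sumTo-0 zero    eq = refl
sumTo-0 (suc n) eq = cong₂ _+_ (sumTo-0 n (λ i i<n → eq i (ℕₚ.m<n⇒m<1+n i<n))) (eq n ℕₚ.≤-refl)

sumTo-mono-≤ : ∀ n {f g : ℕ → ℕ} → (∀ i → i < n → f i ≤ g i) → sumTo n f ≤ sumTo n g
sumTo-mono-≤ zero    le = z≤n
sumTo-mono-≤ (suc n) le = ℕₚ.+-mono-≤ (sumTo-mono-≤ n (λ i i<n → le i (ℕₚ.m<n⇒m<1+n i<n))) (le n ℕₚ.≤-refl)

sumTo-*ˡ : ∀ n c (f : ℕ → ℕ) → sumTo n (λ i → c * f i) ≡ c * sumTo n f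
sumTo-*ˡ zero    c f = sym (ℕₚ.*-zeroʳ c)
sumTo-*ˡ (suc n) c f = trans (cong (_+ c * f n) (sumTo-*ˡ n c f)) (sym (ℕₚ.*-distribˡ-+ c _ (f n)))

sumTo-*ʳ : ∀ n c (f : ℕ → ℕ) → sumTo n (λ i → f i * c) ≡ sumTo n f * c
sumTo-*ʳ n c f = trans (sumTo-cong n (λ i _ → ℕₚ.*-comm (f i) c)) (trans (sumTo-*ˡ n c f) (ℕₚ.*-comm c _))

sumTo-const : ∀ n c → sumTo n (λ _ → c) ≡ n * c
sumTo-const zero    c = refl
sumTo-const (suc n) c = trans (cong (_+ c) (sumTo-const n c)) (ℕₚ.+-comm (n * c) c)

sumTo-unfoldˡ : ∀ n (f : ℕ → ℕ) → sumTo (suc n) f ≡ f 0 + sumTo n (λ i → f (suc i))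
sumTo-unfoldˡ zero    f = ℕₚ.+-comm 0 (f 0)
sumTo-unfoldˡ (suc n) f = trans (cong (_+ f (suc n)) (sumTo-unfoldˡ n f)) (ℕₚ.+-assoc (f 0) _ _)

sumTo-reverse : ∀ m (f : ℕ → ℕ) → sumTo (suc m) (λ i → f (m ∸ i)) ≡ sumTo (suc m) f
sumTo-reverse zero    f = refl
sumTo-reverse (suc m) f = begin
  sumTo (suc (suc m)) (λ i → f (suc m ∸ i)) ≡⟨ sumTo-unfoldˡ (suc m) _ ⟩
  f (suc m) + sumTo (suc m) (λ i → f (m ∸ i)) ≡⟨ cong (f (suc m) +_) (sumTo-reverse m f) ⟩
  f (suc m) + sumTo (suc m) f                 ≡⟨ ℕₚ.+-comm (f (suc m)) _ ⟩
  sumTo (suc (suc m)) f                       ∎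
  where open ≡-Reasoning

sumTo-single : ∀ n i (f : ℕ → ℕ) → i < n → (∀ j → j < n → ¬ j ≡ i → f j ≡ 0) → sumTo n f ≡ f i
sumTo-single (suc n) i f i<1+n others with i ℕₚ.≟ n
... | yes refl = cong (_+ f i) (sumTo-0 n (λ j j<n → others j (ℕₚ.m<n⇒m<1+n j<n) (λ j≡i → ℕₚ.<-irrefl j≡i j<n)))
... | no i≢n = trans (cong₂ _+_ (sumTo-single n i f (ℕₚ.≤∧≢⇒< (ℕₚ.≤-pred i<1+n) i≢n) (λ j j<n → others j (ℕₚ.m<n⇒m<1+n j<n)))
                                (others n ℕₚ.≤-refl (λ n≡i → i≢n (sym n≡i))))
                   (ℕₚ.+-identityʳ (f i))

≤-sumTo : ∀ n (f : ℕ → ℕ) i → i < n → f i ≤ sumTo n f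
≤-sumTo (suc n) f i i<1+n with ℕₚ.m≤n⇒m<n∨m≡n i<1+n
... | inj₂ refl      = ℕₚ.m≤n+m (f n) (sumTo n f)
... | inj₁ (s≤s i<n) = ℕₚ.≤-trans (≤-sumTo n f i i<n) (ℕₚ.m≤m+n (sumTo n f) (f n))

-- Counting prime-power divisors

module DivisorCounting (q : ℕ) where

  open ≡-Reasoning

  -- the number of monic multiples of degree n of a monic polynomial of degree x
  multiples : ℕ → ℕ → ℕ
  multiples n       zero    = q ^ n
  multiples zero    (suc x) = 0
  multiples (suc n) (suc x) = multiples n x

  multiples-suc : ∀ n x → multiples (suc n) x ≡ q * multiples n x + [ x ≡ᵇ suc n ]ᵇ
  multiples-suc n       zero          = sym (ℕₚ.+-identityʳ _)
  multiples-suc zero    (suc zero)    = sym (cong (_+ 1) (ℕₚ.*-zeroʳ q))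
  multiples-suc zero    (suc (suc x)) = sym (trans (ℕₚ.+-identityʳ (q * 0)) (ℕₚ.*-zeroʳ q))
  multiples-suc (suc n) (suc x)       = multiples-suc n x

  multiples-≤ : ∀ n x → x ≤ n → multiples n x ≡ q ^ (n ∸ x)
  multiples-≤ n       zero    _         = refl
  multiples-≤ (suc n) (suc x) (s≤s x≤n) = multiples-≤ n x x≤n

  multiples-> : ∀ n x → n < x → multiples n x ≡ 0
  multiples-> zero    (suc x) _         = refl
  multiples-> (suc n) (suc x) (s≤s n<x) = multiples-> n x n<x

  -- With a e = e · #{monic irreducibles of degree e}, the first sum is Σ_{f ∈ 𝓜_n} deg f
  -- and the second is Σ_{f ∈ 𝓜_m} Λ(f).
  divisorWeight : (ℕ → ℕ) → ℕ → ℕ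
  divisorWeight a n = Σ[ range1 n ] λ e → a e * Σ[ range1 n ] λ j → multiples n (e * j)

  powerWeight : (ℕ → ℕ) → ℕ → ℕ
  powerWeight a m = Σ[ range1 m ] λ e → a e * Σ[ range1 m ] λ j → [ e * j ≡ᵇ m ]ᵇ

  private
    e*[1+n]>n : ∀ n e → 1 ≤ e → n < e * suc n
    e*[1+n]>n n e 1≤e = ℕₚ.<-≤-trans (ℕₚ.n<1+n n) (ℕₚ.≤-trans (ℕₚ.≤-reflexive (sym (ℕₚ.*-identityˡ (suc n)))) (ℕₚ.*-monoˡ-≤ (suc n) 1≤e))

    Σ-multiples-range-suc : ∀ n e → 1 ≤ e →
      Σ[ range1 (suc n) ] (λ j → multiples n (e * j)) ≡ Σ[ range1 n ] (λ j → multiples n (e * j))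
    Σ-multiples-range-suc n e 1≤e = begin
      Σ[ range1 (suc n) ] (λ j → multiples n (e * j))        ≡⟨ Σ-range1 (suc n) _ ⟩
      sumTo n (λ i → multiples n (e * suc i)) + multiples n (e * suc n)
        ≡⟨ cong (sumTo n (λ i → multiples n (e * suc i)) +_) (multiples-> n (e * suc n) (e*[1+n]>n n e 1≤e)) ⟩
      sumTo n (λ i → multiples n (e * suc i)) + 0             ≡⟨ ℕₚ.+-identityʳ _ ⟩
      sumTo n (λ i → multiples n (e * suc i))                 ≡⟨ Σ-range1 n _ ⟨
      Σ[ range1 n ] (λ j → multiples n (e * j))               ∎

    divisorWeight-range-suc : ∀ a n →
      Σ[ range1 (suc n) ] (λ e → a e * Σ[ range1 n ] λ j → multiples n (e * j)) ≡ divisorWeight a n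
    divisorWeight-range-suc a n = begin
      Σ[ range1 (suc n) ] F                   ≡⟨ Σ-range1 (suc n) F ⟩
      sumTo n (λ i → F (suc i)) + F (suc n)   ≡⟨ cong (sumTo n (λ i → F (suc i)) +_) F[1+n]≡0 ⟩
      sumTo n (λ i → F (suc i)) + 0           ≡⟨ ℕₚ.+-identityʳ _ ⟩
      sumTo n (λ i → F (suc i))               ≡⟨ Σ-range1 n F ⟨
      divisorWeight a n                       ∎
      where
      F : ℕ → ℕ
      F e = a e * Σ[ range1 n ] λ j → multiples n (e * j)
      F[1+n]≡0 : F (suc n) ≡ 0
      F[1+n]≡0 = trans (cong (a (suc n) *_) (trans (Σ-range1 n _)
                         (sumTo-0 n (λ i _ → multiples-> n (suc n * suc i) (s≤s (ℕₚ.≤-trans (ℕₚ.m≤m*n n (suc i)) (ℕₚ.m≤n+m (n * suc i) i)))))))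
                       (ℕₚ.*-zeroʳ (a (suc n)))

  divisorWeight-suc : ∀ a n → divisorWeight a (suc n) ≡ q * divisorWeight a n + powerWeight a (suc n)
  divisorWeight-suc a n = begin
    divisorWeight a (suc n)
      ≡⟨ trans (Σ-range1 (suc n) _) (trans (sumTo-cong (suc n) (λ i _ → termwise (suc i) (s≤s z≤n))) (sym (Σ-range1 (suc n) _))) ⟩
    Σ[ range1 (suc n) ] (λ e → q * D e + E e)  ≡⟨ Σ-+ (range1 (suc n)) (λ e → q * D e) E ⟩
    Σ[ range1 (suc n) ] (λ e → q * D e) + powerWeight a (suc n)
      ≡⟨ cong (_+ powerWeight a (suc n)) (trans (Σ-*ˡ (range1 (suc n)) q D) (cong (q *_) (divisorWeight-range-suc a n))) ⟩
    q * divisorWeight a n + powerWeight a (suc n) ∎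
    where
    D E : ℕ → ℕ
    D e = a e * Σ[ range1 n ] λ j → multiples n (e * j)
    E e = a e * Σ[ range1 (suc n) ] λ j → [ e * j ≡ᵇ suc n ]ᵇ
    distrib : ∀ a q x y → a * (q * x + y) ≡ q * (a * x) + a * y
    distrib = solve-∀
    termwise : ∀ e → 1 ≤ e → a e * Σ[ range1 (suc n) ] (λ j → multiples (suc n) (e * j)) ≡ q * D e + E e
    termwise e 1≤e = begin
      a e * Σ[ range1 (suc n) ] (λ j → multiples (suc n) (e * j))
        ≡⟨ cong (a e *_) (trans (Σ-cong (range1 (suc n)) (λ j → multiples-suc n (e * j))) (Σ-+ (range1 (suc n)) (λ j → q * multiples n (e * j)) (λ j → [ e * j ≡ᵇ suc n ]ᵇ))) ⟩
      a e * (Σ[ range1 (suc n) ] (λ j → q * multiples n (e * j)) + Σ[ range1 (suc n) ] λ j → [ e * j ≡ᵇ suc n ]ᵇ)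
        ≡⟨ cong (λ z → a e * (z + Σ[ range1 (suc n) ] λ j → [ e * j ≡ᵇ suc n ]ᵇ))
                (trans (Σ-*ˡ (range1 (suc n)) q _) (cong (q *_) (Σ-multiples-range-suc n e 1≤e))) ⟩
      a e * (q * Σ[ range1 n ] (λ j → multiples n (e * j)) + Σ[ range1 (suc n) ] λ j → [ e * j ≡ᵇ suc n ]ᵇ)
        ≡⟨ distrib (a e) q _ _ ⟩
      q * D e + E e ∎

  -- From Σ_{f ∈ 𝓜_n} deg f = n q^n for all n, the recursion forces Σ_{f ∈ 𝓜_m} Λ(f) = q^m.
  powerWeight≡q^ : ∀ a → (∀ n → divisorWeight a n ≡ n * q ^ n) → ∀ m → 1 ≤ m → powerWeight a m ≡ q ^ m
  powerWeight≡q^ a hyp (suc n) _ = ℕₚ.+-cancelʳ-≡ (n * q ^ suc n) (powerWeight a (suc n)) (q ^ suc n) (begin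
    powerWeight a (suc n) + n * q ^ suc n  ≡⟨ ℕₚ.+-comm (powerWeight a (suc n)) _ ⟩
    n * q ^ suc n + powerWeight a (suc n)  ≡⟨ cong (_+ powerWeight a (suc n)) (swap n q (q ^ n)) ⟩
    q * (n * q ^ n) + powerWeight a (suc n) ≡⟨ cong (λ z → q * z + powerWeight a (suc n)) (hyp n) ⟨
    q * divisorWeight a n + powerWeight a (suc n) ≡⟨ divisorWeight-suc a n ⟨
    divisorWeight a (suc n)                ≡⟨ hyp (suc n) ⟩
    suc n * q ^ suc n                      ∎)
    where
    swap : ∀ n q y → n * (q * y) ≡ q * (n * y)
    swap = solve-∀

module OverFiniteField (𝔽 : FiniteField) where

  open FiniteField 𝔽
  open ≡-Reasoning

  ring : CommutativeRing 0ℓ 0ℓ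
  ring = record { isCommutativeRing = isCommutativeRing }

  open CommutativeRing ring
    using (+-assoc; +-comm; +-identityˡ; +-identityʳ; -‿inverseˡ; -‿inverseʳ;
           *-assoc; *-comm; *-identityˡ; *-identityʳ; distribˡ; distribʳ; zeroˡ; zeroʳ)
  open RingProperties (CommutativeRing.ring ring)
    using (-‿distribˡ-*; -0#≈0#; -‿anti-homo-+; x∙y⁻¹≈ε⇒x≈y; xyx⁻¹≈y)
  open CommutativeSemigroupProperties (CommutativeRing.+-commutativeSemigroup ring)
    using () renaming (interchange to +-interchange)

  infixl 6 _+ᶠ_ _−ᶠ_
  infixl 7 _*ᶠ_
  infix  8 -ᶠ_

  𝕜 : Set
  𝕜 = Fin q

  _+ᶠ_ _*ᶠ_ _−ᶠ_ : 𝕜 → 𝕜 → 𝕜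
  _+ᶠ_ = _+F_
  _*ᶠ_ = _*F_
  x −ᶠ y = x +F (-F y)

  -ᶠ_ : 𝕜 → 𝕜
  -ᶠ_ = -F_

  1≢0 : ¬ 1F ≡ 0F
  1≢0 1≡0 = 0≢1 (sym 1≡0)

  x+y≡z⇒y≡z−x : ∀ x y z → x +ᶠ y ≡ z → y ≡ z −ᶠ x
  x+y≡z⇒y≡z−x x y z eq = trans (sym (xyx⁻¹≈y x y)) (cong (_−ᶠ x) eq)

  inverseˡ : ∀ x (x≢0 : ¬ x ≡ 0F) → inv x x≢0 *ᶠ x ≡ 1F
  inverseˡ x x≢0 = trans (*-comm _ _) (inv-correct x x≢0)

  *ᶠ≡0⇒ : ∀ x y → x *ᶠ y ≡ 0F → x ≡ 0F ⊎ y ≡ 0F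
  *ᶠ≡0⇒ x y xy≡0 with x ≟ᶠ 0F
  ... | yes x≡0 = inj₁ x≡0
  ... | no  x≢0 = inj₂ (begin
    y                          ≡⟨ *-identityˡ y ⟨
    1F *ᶠ y                    ≡⟨ cong (_*ᶠ y) (inverseˡ x x≢0) ⟨
    (inv x x≢0 *ᶠ x) *ᶠ y      ≡⟨ *-assoc _ x y ⟩
    inv x x≢0 *ᶠ (x *ᶠ y)      ≡⟨ cong (inv x x≢0 *ᶠ_) xy≡0 ⟩
    inv x x≢0 *ᶠ 0F            ≡⟨ zeroʳ _ ⟩
    0F                         ∎)

  private
    2≤size : ∀ n (a b : Fin n) → ¬ a ≡ b → 2 ≤ n
    2≤size (suc zero)    fzero fzero a≢b = ⊥-elim (a≢b refl)
    2≤size (suc (suc n)) a     b     _   = s≤s (s≤s z≤n)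

  2≤q : 2 ≤ q
  2≤q = 2≤size q 0F 1F 0≢1

  1≤q : 1 ≤ q
  1≤q = ℕₚ.≤-trans (s≤s z≤n) 2≤q

  q^-mono-≤ : ∀ {a b} → a ≤ b → q ^ a ≤ q ^ b
  q^-mono-≤ = ℕₚ.^-monoʳ-≤ q {{>-nonZero 1≤q}}


  -- Polynomial arithmetic, up to coefficientwise equality

  Pol : Set
  Pol = Poly 𝔽

  infixl 6 _⊕_ _⊖_
  infixl 7 _⊗_
  infixr 8 _·_
  infix  8 ⊝_

  _⊕_ _⊗_ _⊖_ : Pol → Pol → Pol
  _⊕_ = addP 𝔽
  _⊗_ = mulP 𝔽
  _⊖_ = subP 𝔽

  ⊝_ : Pol → Pol
  ⊝_ = negP 𝔽

  _·_ : 𝕜 → Pol → Pol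
  c · p = map (c *ᶠ_) p

  coeff : Pol → ℕ → 𝕜
  coeff []       i       = 0F
  coeff (x ∷ xs) zero    = x
  coeff (x ∷ xs) (suc i) = coeff xs i

  coeff-[0] : ∀ i → coeff (0F ∷ []) i ≡ 0F
  coeff-[0] zero    = refl
  coeff-[0] (suc i) = refl

  infix 4 _≈_
  record _≈_ (p r : Pol) : Set where
    constructor mk≈
    field at : ∀ i → coeff p i ≡ coeff r i
  open _≈_ public

  ≈-refl : ∀ {p} → p ≈ p
  ≈-refl .at i = refl

  ≈-sym : ∀ {p r} → p ≈ r → r ≈ p
  ≈-sym e .at i = sym (e .at i)

  ≈-trans : ∀ {p r s} → p ≈ r → r ≈ s → p ≈ s
  ≈-trans e f .at i = trans (e .at i) (f .at i)

  ≈-tail : ∀ {x y xs ys} → (x ∷ xs) ≈ (y ∷ ys) → xs ≈ ys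
  ≈-tail e .at i = e .at (suc i)

  coeff-⊕ : ∀ p r i → coeff (p ⊕ r) i ≡ coeff p i +ᶠ coeff r i
  coeff-⊕ []       r        i       = sym (+-identityˡ _)
  coeff-⊕ (x ∷ xs) []       zero    = sym (+-identityʳ x)
  coeff-⊕ (x ∷ xs) []       (suc i) = sym (+-identityʳ _)
  coeff-⊕ (x ∷ xs) (y ∷ ys) zero    = refl
  coeff-⊕ (x ∷ xs) (y ∷ ys) (suc i) = coeff-⊕ xs ys i

  coeff-map : ∀ (g : 𝕜 → 𝕜) → g 0F ≡ 0F → ∀ p i → coeff (map g p) i ≡ g (coeff p i)
  coeff-map g g0≡0 []       i       = sym g0≡0
  coeff-map g g0≡0 (x ∷ xs) zero    = refl
  coeff-map g g0≡0 (x ∷ xs) (suc i) = coeff-map g g0≡0 xs i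

  coeff-· : ∀ c p i → coeff (c · p) i ≡ c *ᶠ coeff p i
  coeff-· c = coeff-map (c *ᶠ_) (zeroʳ c)

  coeff-⊝ : ∀ p i → coeff (⊝ p) i ≡ -ᶠ coeff p i
  coeff-⊝ = coeff-map -ᶠ_ -0#≈0#

  coeff-⊖ : ∀ p r i → coeff (p ⊖ r) i ≡ coeff p i −ᶠ coeff r i
  coeff-⊖ p r i = trans (coeff-⊕ p (⊝ r) i) (cong (coeff p i +ᶠ_) (coeff-⊝ r i))

  coeff-∷-⊗ : ∀ x xs r i → coeff ((x ∷ xs) ⊗ r) i ≡ x *ᶠ coeff r i +ᶠ coeff (0F ∷ (xs ⊗ r)) i
  coeff-∷-⊗ x xs r i = trans (coeff-⊕ (x · r) (0F ∷ (xs ⊗ r)) i) (cong (_+ᶠ coeff (0F ∷ (xs ⊗ r)) i) (coeff-· x r i))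

  coeff-0∷-⊕ : ∀ t u i → coeff (0F ∷ (t ⊕ u)) i ≡ coeff (0F ∷ t) i +ᶠ coeff (0F ∷ u) i
  coeff-0∷-⊕ t u zero    = sym (+-identityˡ 0F)
  coeff-0∷-⊕ t u (suc i) = coeff-⊕ t u i

  coeff-0∷-· : ∀ c t i → coeff (0F ∷ c · t) i ≡ c *ᶠ coeff (0F ∷ t) i
  coeff-0∷-· c t zero    = sym (zeroʳ c)
  coeff-0∷-· c t (suc i) = coeff-· c t i

  coeff-0∷-⊝ : ∀ t i → coeff (0F ∷ ⊝ t) i ≡ -ᶠ coeff (0F ∷ t) i
  coeff-0∷-⊝ t zero    = sym -0#≈0#
  coeff-0∷-⊝ t (suc i) = coeff-⊝ t i

  ∷-cong : ∀ {x y t u} → x ≡ y → t ≈ u → (x ∷ t) ≈ (y ∷ u)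
  ∷-cong e f .at zero    = e
  ∷-cong e f .at (suc i) = f .at i

  ⊕-cong : ∀ {p p′ r r′} → p ≈ p′ → r ≈ r′ → p ⊕ r ≈ p′ ⊕ r′
  ⊕-cong {p} {p′} {r} {r′} e f .at i = trans (coeff-⊕ p r i) (trans (cong₂ _+ᶠ_ (e .at i) (f .at i)) (sym (coeff-⊕ p′ r′ i)))

  ·-congʳ : ∀ c {p p′} → p ≈ p′ → c · p ≈ c · p′
  ·-congʳ c {p} {p′} e .at i = trans (coeff-· c p i) (trans (cong (c *ᶠ_) (e .at i)) (sym (coeff-· c p′ i)))

  ⊝-cong : ∀ {p p′} → p ≈ p′ → ⊝ p ≈ ⊝ p′
  ⊝-cong {p} {p′} e .at i = trans (coeff-⊝ p i) (trans (cong -ᶠ_ (e .at i)) (sym (coeff-⊝ p′ i)))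

  ⊖-cong : ∀ {p p′ r r′} → p ≈ p′ → r ≈ r′ → p ⊖ r ≈ p′ ⊖ r′
  ⊖-cong e f = ⊕-cong e (⊝-cong f)

  ⊗-congʳ : ∀ p {r r′} → r ≈ r′ → p ⊗ r ≈ p ⊗ r′
  ⊗-congʳ []       e .at i = refl
  ⊗-congʳ (x ∷ xs) {r} {r′} e .at i = trans (coeff-∷-⊗ x xs r i)
    (trans (cong₂ _+ᶠ_ (cong (x *ᶠ_) (e .at i)) (∷-cong refl (⊗-congʳ xs e) .at i)) (sym (coeff-∷-⊗ x xs r′ i)))

  ⊗-zeroˡ : ∀ p r → p ≈ [] → p ⊗ r ≈ []
  ⊗-zeroˡ []       r e .at i = refl
  ⊗-zeroˡ (x ∷ xs) r e .at i = begin
    coeff ((x ∷ xs) ⊗ r) i                                ≡⟨ coeff-∷-⊗ x xs r i ⟩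
    x *ᶠ coeff r i +ᶠ coeff (0F ∷ (xs ⊗ r)) i             ≡⟨ cong₂ _+ᶠ_ (cong (_*ᶠ coeff r i) (e .at 0)) (∷-cong refl (⊗-zeroˡ xs r (mk≈ λ j → e .at (suc j))) .at i) ⟩
    0F *ᶠ coeff r i +ᶠ coeff (0F ∷ []) i                  ≡⟨ cong₂ _+ᶠ_ (zeroˡ (coeff r i)) (coeff-[0] i) ⟩
    0F +ᶠ 0F                                              ≡⟨ +-identityˡ 0F ⟩
    0F                                                    ∎

  ⊗-congˡ : ∀ {p p′} r → p ≈ p′ → p ⊗ r ≈ p′ ⊗ r
  ⊗-congˡ {[]}     {[]}     r e = ≈-refl
  ⊗-congˡ {[]}     {y ∷ ys} r e = ≈-sym (⊗-zeroˡ (y ∷ ys) r (≈-sym e))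
  ⊗-congˡ {x ∷ xs} {[]}     r e = ⊗-zeroˡ (x ∷ xs) r e
  ⊗-congˡ {x ∷ xs} {y ∷ ys} r e .at i = trans (coeff-∷-⊗ x xs r i) (trans
    (cong₂ _+ᶠ_ (cong (_*ᶠ coeff r i) (e .at 0)) (∷-cong refl (⊗-congˡ r (≈-tail e)) .at i)) (sym (coeff-∷-⊗ y ys r i)))

  ⊗-cong : ∀ {p p′ r r′} → p ≈ p′ → r ≈ r′ → p ⊗ r ≈ p′ ⊗ r′
  ⊗-cong {p′ = p′} {r = r} e f = ≈-trans (⊗-congˡ r e) (⊗-congʳ p′ f)

  ⊕-identityʳ : ∀ p → p ⊕ [] ≈ p
  ⊕-identityʳ p .at i = trans (coeff-⊕ p [] i) (+-identityʳ _)

  ⊗-distribˡ : ∀ p r s → p ⊗ (r ⊕ s) ≈ p ⊗ r ⊕ p ⊗ s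
  ⊗-distribˡ []       r s .at i = refl
  ⊗-distribˡ (x ∷ xs) r s .at i = begin
    coeff ((x ∷ xs) ⊗ (r ⊕ s)) i
      ≡⟨ coeff-∷-⊗ x xs (r ⊕ s) i ⟩
    x *ᶠ coeff (r ⊕ s) i +ᶠ coeff (0F ∷ (xs ⊗ (r ⊕ s))) i
      ≡⟨ cong₂ _+ᶠ_ (trans (cong (x *ᶠ_) (coeff-⊕ r s i)) (distribˡ x _ _))
                    (trans (∷-cong refl (⊗-distribˡ xs r s) .at i) (coeff-0∷-⊕ (xs ⊗ r) (xs ⊗ s) i)) ⟩
    (x *ᶠ coeff r i +ᶠ x *ᶠ coeff s i) +ᶠ (coeff (0F ∷ (xs ⊗ r)) i +ᶠ coeff (0F ∷ (xs ⊗ s)) i)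
      ≡⟨ +-interchange _ _ _ _ ⟩
    (x *ᶠ coeff r i +ᶠ coeff (0F ∷ (xs ⊗ r)) i) +ᶠ (x *ᶠ coeff s i +ᶠ coeff (0F ∷ (xs ⊗ s)) i)
      ≡⟨ cong₂ _+ᶠ_ (coeff-∷-⊗ x xs r i) (coeff-∷-⊗ x xs s i) ⟨
    coeff ((x ∷ xs) ⊗ r) i +ᶠ coeff ((x ∷ xs) ⊗ s) i
      ≡⟨ coeff-⊕ ((x ∷ xs) ⊗ r) ((x ∷ xs) ⊗ s) i ⟨
    coeff ((x ∷ xs) ⊗ r ⊕ (x ∷ xs) ⊗ s) i ∎

  ⊗-distribʳ : ∀ p s r → (p ⊕ s) ⊗ r ≈ p ⊗ r ⊕ s ⊗ r
  ⊗-distribʳ []       s        r .at i = refl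
  ⊗-distribʳ (x ∷ xs) []       r = ≈-sym (⊕-identityʳ _)
  ⊗-distribʳ (x ∷ xs) (y ∷ ys) r .at i = begin
    coeff (((x +ᶠ y) ∷ (xs ⊕ ys)) ⊗ r) i
      ≡⟨ coeff-∷-⊗ (x +ᶠ y) (xs ⊕ ys) r i ⟩
    (x +ᶠ y) *ᶠ coeff r i +ᶠ coeff (0F ∷ ((xs ⊕ ys) ⊗ r)) i
      ≡⟨ cong₂ _+ᶠ_ (distribʳ (coeff r i) x y) (trans (∷-cong refl (⊗-distribʳ xs ys r) .at i) (coeff-0∷-⊕ (xs ⊗ r) (ys ⊗ r) i)) ⟩
    (x *ᶠ coeff r i +ᶠ y *ᶠ coeff r i) +ᶠ (coeff (0F ∷ (xs ⊗ r)) i +ᶠ coeff (0F ∷ (ys ⊗ r)) i)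
      ≡⟨ +-interchange _ _ _ _ ⟩
    (x *ᶠ coeff r i +ᶠ coeff (0F ∷ (xs ⊗ r)) i) +ᶠ (y *ᶠ coeff r i +ᶠ coeff (0F ∷ (ys ⊗ r)) i)
      ≡⟨ cong₂ _+ᶠ_ (coeff-∷-⊗ x xs r i) (coeff-∷-⊗ y ys r i) ⟨
    coeff ((x ∷ xs) ⊗ r) i +ᶠ coeff ((y ∷ ys) ⊗ r) i
      ≡⟨ coeff-⊕ ((x ∷ xs) ⊗ r) ((y ∷ ys) ⊗ r) i ⟨
    coeff ((x ∷ xs) ⊗ r ⊕ (y ∷ ys) ⊗ r) i ∎

  ·-⊗ : ∀ c p r → c · p ⊗ r ≈ c · (p ⊗ r)
  ·-⊗ c []       r .at i = refl
  ·-⊗ c (x ∷ xs) r .at i = begin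
    coeff ((c *ᶠ x ∷ c · xs) ⊗ r) i                        ≡⟨ coeff-∷-⊗ (c *ᶠ x) (c · xs) r i ⟩
    (c *ᶠ x) *ᶠ coeff r i +ᶠ coeff (0F ∷ (c · xs ⊗ r)) i   ≡⟨ cong₂ _+ᶠ_ (*-assoc c x _) (trans (∷-cong refl (·-⊗ c xs r) .at i) (coeff-0∷-· c (xs ⊗ r) i)) ⟩
    c *ᶠ (x *ᶠ coeff r i) +ᶠ c *ᶠ coeff (0F ∷ (xs ⊗ r)) i  ≡⟨ distribˡ c _ _ ⟨
    c *ᶠ (x *ᶠ coeff r i +ᶠ coeff (0F ∷ (xs ⊗ r)) i)       ≡⟨ cong (c *ᶠ_) (coeff-∷-⊗ x xs r i) ⟨
    c *ᶠ coeff ((x ∷ xs) ⊗ r) i                            ≡⟨ coeff-· c ((x ∷ xs) ⊗ r) i ⟨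
    coeff (c · ((x ∷ xs) ⊗ r)) i                           ∎

  ⊗-zeroʳ : ∀ p → p ⊗ [] ≈ []
  ⊗-zeroʳ []       = ≈-refl
  ⊗-zeroʳ (x ∷ xs) .at i = trans (coeff-∷-⊗ x xs [] i)
    (trans (cong₂ _+ᶠ_ (zeroʳ x) (∷-cong refl (⊗-zeroʳ xs) .at i)) (trans (+-identityˡ _) (coeff-[0] i)))

  ⊗-∷ʳ : ∀ p y ys → p ⊗ (y ∷ ys) ≈ y · p ⊕ (0F ∷ (p ⊗ ys))
  ⊗-∷ʳ []       y ys .at i = sym (trans (coeff-⊕ [] (0F ∷ []) i) (trans (+-identityˡ _) (coeff-[0] i)))
  ⊗-∷ʳ (x ∷ xs) y ys .at zero = begin
    coeff ((x ∷ xs) ⊗ (y ∷ ys)) 0                     ≡⟨ coeff-∷-⊗ x xs (y ∷ ys) 0 ⟩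
    x *ᶠ y +ᶠ 0F                                      ≡⟨ cong (_+ᶠ 0F) (*-comm x y) ⟩
    y *ᶠ x +ᶠ 0F                                      ≡⟨ coeff-⊕ (y · (x ∷ xs)) (0F ∷ ((x ∷ xs) ⊗ ys)) 0 ⟨
    coeff (y · (x ∷ xs) ⊕ (0F ∷ ((x ∷ xs) ⊗ ys))) 0   ∎
  ⊗-∷ʳ (x ∷ xs) y ys .at (suc i) = begin
    coeff ((x ∷ xs) ⊗ (y ∷ ys)) (suc i)
      ≡⟨ coeff-∷-⊗ x xs (y ∷ ys) (suc i) ⟩
    x *ᶠ coeff ys i +ᶠ coeff (xs ⊗ (y ∷ ys)) i
      ≡⟨ cong (x *ᶠ coeff ys i +ᶠ_) (trans (⊗-∷ʳ xs y ys .at i) (coeff-⊕ (y · xs) (0F ∷ (xs ⊗ ys)) i)) ⟩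
    x *ᶠ coeff ys i +ᶠ (coeff (y · xs) i +ᶠ coeff (0F ∷ (xs ⊗ ys)) i)
      ≡⟨ +-assoc _ _ _ ⟨
    (x *ᶠ coeff ys i +ᶠ coeff (y · xs) i) +ᶠ coeff (0F ∷ (xs ⊗ ys)) i
      ≡⟨ cong (_+ᶠ coeff (0F ∷ (xs ⊗ ys)) i) (+-comm _ _) ⟩
    (coeff (y · xs) i +ᶠ x *ᶠ coeff ys i) +ᶠ coeff (0F ∷ (xs ⊗ ys)) i
      ≡⟨ +-assoc _ _ _ ⟩
    coeff (y · xs) i +ᶠ (x *ᶠ coeff ys i +ᶠ coeff (0F ∷ (xs ⊗ ys)) i)
      ≡⟨ cong (coeff (y · xs) i +ᶠ_) (coeff-∷-⊗ x xs ys i) ⟨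
    coeff (y · xs) i +ᶠ coeff ((x ∷ xs) ⊗ ys) i
      ≡⟨ coeff-⊕ (y · (x ∷ xs)) (0F ∷ ((x ∷ xs) ⊗ ys)) (suc i) ⟨
    coeff (y · (x ∷ xs) ⊕ (0F ∷ ((x ∷ xs) ⊗ ys))) (suc i) ∎

  ⊗-comm : ∀ p r → p ⊗ r ≈ r ⊗ p
  ⊗-comm []       r = ≈-sym (⊗-zeroʳ r)
  ⊗-comm (x ∷ xs) r = ≈-trans (⊕-cong (≈-refl {x · r}) (∷-cong refl (⊗-comm xs r))) (≈-sym (⊗-∷ʳ r x xs))

  ⊗-· : ∀ c p r → p ⊗ c · r ≈ c · (p ⊗ r)
  ⊗-· c p r = ≈-trans (⊗-comm p (c · r)) (≈-trans (·-⊗ c r p) (·-congʳ c (⊗-comm r p)))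

  0∷-⊗ : ∀ t s → (0F ∷ t) ⊗ s ≈ 0F ∷ (t ⊗ s)
  0∷-⊗ t s = ⊕-cong 0·s≈[] (≈-refl {0F ∷ (t ⊗ s)})
    where
    0·s≈[] : 0F · s ≈ []
    0·s≈[] .at i = trans (coeff-· 0F s i) (zeroˡ _)

  [c]⊗ : ∀ c p → (c ∷ []) ⊗ p ≈ c · p
  [c]⊗ c p .at i = trans (coeff-∷-⊗ c [] p i) (trans (cong (c *ᶠ coeff p i +ᶠ_) (coeff-[0] i)) (trans (+-identityʳ _) (sym (coeff-· c p i))))

  ⊗-assoc : ∀ p r s → (p ⊗ r) ⊗ s ≈ p ⊗ (r ⊗ s)
  ⊗-assoc []       r s = ≈-refl
  ⊗-assoc (x ∷ xs) r s = ≈-trans (⊗-distribʳ (x · r) (0F ∷ (xs ⊗ r)) s)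
    (⊕-cong (·-⊗ x r s) (≈-trans (0∷-⊗ (xs ⊗ r) s) (∷-cong refl (⊗-assoc xs r s))))

  ⊗-identityˡ : ∀ p → oneP 𝔽 ⊗ p ≈ p
  ⊗-identityˡ p = ≈-trans ([c]⊗ 1F p) (mk≈ λ i → trans (coeff-· 1F p i) (*-identityˡ _))

  ⊗-identityʳ : ∀ p → p ⊗ oneP 𝔽 ≈ p
  ⊗-identityʳ p = ≈-trans (⊗-comm p (oneP 𝔽)) (⊗-identityˡ p)

  ⊝-⊗ : ∀ p r → ⊝ p ⊗ r ≈ ⊝ (p ⊗ r)
  ⊝-⊗ []       r .at i = refl
  ⊝-⊗ (x ∷ xs) r .at i = begin
    coeff ((-ᶠ x ∷ ⊝ xs) ⊗ r) i                            ≡⟨ coeff-∷-⊗ (-ᶠ x) (⊝ xs) r i ⟩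
    (-ᶠ x) *ᶠ coeff r i +ᶠ coeff (0F ∷ (⊝ xs ⊗ r)) i       ≡⟨ cong₂ _+ᶠ_ (sym (-‿distribˡ-* x _)) (trans (∷-cong refl (⊝-⊗ xs r) .at i) (coeff-0∷-⊝ (xs ⊗ r) i)) ⟩
    -ᶠ (x *ᶠ coeff r i) +ᶠ -ᶠ coeff (0F ∷ (xs ⊗ r)) i      ≡⟨ -‿anti-homo-+ _ _ ⟨
    -ᶠ (coeff (0F ∷ (xs ⊗ r)) i +ᶠ x *ᶠ coeff r i)         ≡⟨ cong -ᶠ_ (trans (+-comm _ _) (sym (coeff-∷-⊗ x xs r i))) ⟩
    -ᶠ coeff ((x ∷ xs) ⊗ r) i                              ≡⟨ coeff-⊝ ((x ∷ xs) ⊗ r) i ⟨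
    coeff (⊝ ((x ∷ xs) ⊗ r)) i                             ∎

  ⊗-distrib-⊖ˡ : ∀ p r s → p ⊗ (r ⊖ s) ≈ p ⊗ r ⊖ p ⊗ s
  ⊗-distrib-⊖ˡ p r s = ≈-trans (⊗-distribˡ p r (⊝ s))
    (⊕-cong (≈-refl {p ⊗ r}) (≈-trans (⊗-comm p (⊝ s)) (≈-trans (⊝-⊗ s p) (⊝-cong (⊗-comm s p)))))

  ⊗-distrib-⊖ʳ : ∀ p s r → (p ⊖ s) ⊗ r ≈ p ⊗ r ⊖ s ⊗ r
  ⊗-distrib-⊖ʳ p s r = ≈-trans (⊗-distribʳ p (⊝ s) r) (⊕-cong (≈-refl {p ⊗ r}) (⊝-⊗ s r))

  ⊖≈[]⇒≈ : ∀ p r → p ⊖ r ≈ [] → p ≈ r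
  ⊖≈[]⇒≈ p r e .at i = x∙y⁻¹≈ε⇒x≈y _ _ (trans (sym (coeff-⊖ p r i)) (e .at i))

  ≈⇒⊖≈[] : ∀ p r → p ≈ r → p ⊖ r ≈ []
  ≈⇒⊖≈[] p r e .at i = trans (coeff-⊖ p r i) (trans (cong (_−ᶠ coeff r i) (e .at i)) (-‿inverseʳ _))

  isZero : 𝕜 → Bool
  isZero = isZeroᶜ 𝔽

  isZero-true : ∀ x → x ≡ 0F → isZero x ≡ true
  isZero-true x = dec-true (x ≟ᶠ 0F)

  isZero-false : ∀ x → ¬ x ≡ 0F → isZero x ≡ false
  isZero-false x = dec-false (x ≟ᶠ 0F)

  Normal : Pol → Set
  Normal []           = ⊤
  Normal (x ∷ [])     = ¬ x ≡ 0F
  Normal (x ∷ y ∷ ys) = Normal (y ∷ ys)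

  _∷ₙ_ : 𝕜 → Pol → Pol
  x ∷ₙ []       = if isZero x then [] else x ∷ []
  x ∷ₙ (y ∷ ys) = x ∷ y ∷ ys

  private
    dropZeros-snoc : List 𝕜 → 𝕜 → List 𝕜
    dropZeros-snoc []       x = dropZeros 𝔽 [ x ]
    dropZeros-snoc (z ∷ zs) x = z ∷ (zs ++ [ x ])

    dropZeros-++ : ∀ ys x → dropZeros 𝔽 (ys ++ [ x ]) ≡ dropZeros-snoc (dropZeros 𝔽 ys) x
    dropZeros-++ []       x = refl
    dropZeros-++ (y ∷ ys) x with y ≟ᶠ 0F
    ... | yes _ = dropZeros-++ ys x
    ... | no  _ = refl

    ∷ₙ-++ : ∀ x ws z → x ∷ₙ (ws ++ [ z ]) ≡ x ∷ (ws ++ [ z ])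
    ∷ₙ-++ x []       z = refl
    ∷ₙ-++ x (w ∷ ws) z = refl

    reverse-dropZeros-snoc : ∀ zs x → reverse (dropZeros-snoc zs x) ≡ x ∷ₙ reverse zs
    reverse-dropZeros-snoc []       x with x ≟ᶠ 0F
    ... | yes _ = refl
    ... | no  _ = refl
    reverse-dropZeros-snoc (z ∷ zs) x = begin
      reverse ((z ∷ zs) ++ [ x ])   ≡⟨ reverse-++ (z ∷ zs) [ x ] ⟩
      x ∷ reverse (z ∷ zs)          ≡⟨ cong (x ∷_) (unfold-reverse z zs) ⟩
      x ∷ (reverse zs ++ [ z ])     ≡⟨ ∷ₙ-++ x (reverse zs) z ⟨
      x ∷ₙ (reverse zs ++ [ z ])    ≡⟨ cong (x ∷ₙ_) (unfold-reverse z zs) ⟨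
      x ∷ₙ reverse (z ∷ zs)         ∎

  normalize-∷ : ∀ x xs → normalize 𝔽 (x ∷ xs) ≡ x ∷ₙ normalize 𝔽 xs
  normalize-∷ x xs = begin
    reverse (dropZeros 𝔽 (reverse (x ∷ xs)))        ≡⟨ cong (λ l → reverse (dropZeros 𝔽 l)) (unfold-reverse x xs) ⟩
    reverse (dropZeros 𝔽 (reverse xs ++ [ x ]))     ≡⟨ cong reverse (dropZeros-++ (reverse xs) x) ⟩
    reverse (dropZeros-snoc (dropZeros 𝔽 (reverse xs)) x) ≡⟨ reverse-dropZeros-snoc (dropZeros 𝔽 (reverse xs)) x ⟩
    x ∷ₙ normalize 𝔽 xs                            ∎

  coeff-∷ₙ : ∀ x t i → coeff (x ∷ₙ t) i ≡ coeff (x ∷ t) i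
  coeff-∷ₙ x []       i with x ≟ᶠ 0F
  coeff-∷ₙ x []       zero    | yes x≡0 = sym x≡0
  coeff-∷ₙ x []       (suc i) | yes _   = refl
  ... | no _ = refl
  coeff-∷ₙ x (y ∷ ys) i = refl

  Normal-∷ₙ : ∀ x t → Normal t → Normal (x ∷ₙ t)
  Normal-∷ₙ x []       _ with x ≟ᶠ 0F
  ... | yes _   = tt
  ... | no  x≢0 = x≢0
  Normal-∷ₙ x (y ∷ ys) nt = nt

  coeff-normalize : ∀ p i → coeff (normalize 𝔽 p) i ≡ coeff p i
  coeff-normalize []       i = refl
  coeff-normalize (x ∷ xs) i =
    trans (cong (λ l → coeff l i) (normalize-∷ x xs)) (trans (coeff-∷ₙ x (normalize 𝔽 xs) i) (∷-cong refl (mk≈ (coeff-normalize xs)) .at i))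

  normalize≈ : ∀ p → normalize 𝔽 p ≈ p
  normalize≈ p = mk≈ (coeff-normalize p)

  Normal-normalize : ∀ p → Normal (normalize 𝔽 p)
  Normal-normalize []       = tt
  Normal-normalize (x ∷ xs) = subst Normal (sym (normalize-∷ x xs)) (Normal-∷ₙ x (normalize 𝔽 xs) (Normal-normalize xs))

  Normal-tail : ∀ x xs → Normal (x ∷ xs) → Normal xs
  Normal-tail x []       _  = tt
  Normal-tail x (y ∷ ys) nt = nt

  Normal-∷⇒≉[] : ∀ x xs → Normal (x ∷ xs) → ¬ (x ∷ xs) ≈ []
  Normal-∷⇒≉[] x []       nt e = nt (e .at 0)
  Normal-∷⇒≉[] x (y ∷ ys) nt e = Normal-∷⇒≉[] y ys nt (mk≈ λ i → e .at (suc i))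

  Normal-≈⇒≡ : ∀ a b → Normal a → Normal b → a ≈ b → a ≡ b
  Normal-≈⇒≡ []       []       na nb e = refl
  Normal-≈⇒≡ []       (y ∷ ys) na nb e = ⊥-elim (Normal-∷⇒≉[] y ys nb (≈-sym e))
  Normal-≈⇒≡ (x ∷ xs) []       na nb e = ⊥-elim (Normal-∷⇒≉[] x xs na e)
  Normal-≈⇒≡ (x ∷ xs) (y ∷ ys) na nb e =
    cong₂ _∷_ (e .at 0) (Normal-≈⇒≡ xs ys (Normal-tail x xs na) (Normal-tail y ys nb) (≈-tail e))

  infix 4 _==_
  _==_ : Pol → Pol → Bool
  _==_ = _==P_ 𝔽

  normalize-cong : ∀ p r → p ≈ r → normalize 𝔽 p ≡ normalize 𝔽 r
  normalize-cong p r e = Normal-≈⇒≡ _ _ (Normal-normalize p) (Normal-normalize r)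
    (≈-trans (normalize≈ p) (≈-trans e (≈-sym (normalize≈ r))))

  ≡-normalize⇒≈ : ∀ p r → normalize 𝔽 p ≡ normalize 𝔽 r → p ≈ r
  ≡-normalize⇒≈ p r e = ≈-trans (≈-sym (normalize≈ p)) (≈-trans (mk≈ λ i → cong (λ l → coeff l i) e) (normalize≈ r))

  ==-true : ∀ p r → p ≈ r → (p == r) ≡ true
  ==-true p r e = dec-true (≡-dec _≟ᶠ_ (normalize 𝔽 p) (normalize 𝔽 r)) (normalize-cong p r e)

  ==-false : ∀ p r → ¬ p ≈ r → (p == r) ≡ false
  ==-false p r ne = dec-false (≡-dec _≟ᶠ_ (normalize 𝔽 p) (normalize 𝔽 r)) (λ e → ne (≡-normalize⇒≈ p r e))

  ==-sound : ∀ p r → (p == r) ≡ true → p ≈ r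
  ==-sound p r eq with ≡-dec _≟ᶠ_ (normalize 𝔽 p) (normalize 𝔽 r)
  ... | yes e = ≡-normalize⇒≈ p r e

  _≈?_ : ∀ p r → Dec (p ≈ r)
  p ≈? r with p == r in eq
  ... | true  = yes (==-sound p r eq)
  ... | false = no (λ e → false≢true (trans (sym eq) (==-true p r e)))
    where
    false≢true : false ≡ true → ⊥
    false≢true ()

  [==]ᵇ≡1 : ∀ p r → p ≈ r → [ p == r ]ᵇ ≡ 1
  [==]ᵇ≡1 p r e = cong [_]ᵇ (==-true p r e)

  [==]ᵇ≡0 : ∀ p r → ¬ p ≈ r → [ p == r ]ᵇ ≡ 0
  [==]ᵇ≡0 p r e = cong [_]ᵇ (==-false p r e)

  [∧]ᵇ : ∀ a b → [ a ∧ b ]ᵇ ≡ [ a ]ᵇ * [ b ]ᵇ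
  [∧]ᵇ true  true  = refl
  [∧]ᵇ true  false = refl
  [∧]ᵇ false b     = refl

  [_]ᵇ≤1 : ∀ b → [ b ]ᵇ ≤ 1
  [ true  ]ᵇ≤1 = s≤s z≤n
  [ false ]ᵇ≤1 = z≤n

  ⟦_⟧ : ∀ {d} → Monic 𝔽 d → Pol
  ⟦_⟧ = toPoly 𝔽

  VanishesFrom : Pol → ℕ → Set
  VanishesFrom p m = ∀ i → m ≤ i → coeff p i ≡ 0F

  IsMonic : ℕ → Pol → Set
  IsMonic m p = (coeff p m ≡ 1F) × VanishesFrom p (suc m)

  ⟦⟧-monic : ∀ {d} (v : Monic 𝔽 d) → IsMonic d ⟦ v ⟧
  ⟦⟧-monic []ᵥ       = refl , λ { (suc j) _ → refl }
  ⟦⟧-monic (x ∷ᵥ v) = proj₁ (⟦⟧-monic v) , λ { (suc j) (s≤s le) → proj₂ (⟦⟧-monic v) j le }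

  lowerCoeffs : (m : ℕ) → Pol → Monic 𝔽 m
  lowerCoeffs zero    p        = []ᵥ
  lowerCoeffs (suc m) []       = 0F ∷ᵥ lowerCoeffs m []
  lowerCoeffs (suc m) (x ∷ xs) = x ∷ᵥ lowerCoeffs m xs

  ≈⟦lowerCoeffs⟧ : ∀ m p → IsMonic m p → p ≈ ⟦ lowerCoeffs m p ⟧
  ≈⟦lowerCoeffs⟧ zero    p        (lead , vanish) = mk≈ λ { zero → lead ; (suc i) → vanish (suc i) (s≤s z≤n) }
  ≈⟦lowerCoeffs⟧ (suc m) []       (lead , _)      = ⊥-elim (0≢1 lead)
  ≈⟦lowerCoeffs⟧ (suc m) (x ∷ xs) (lead , vanish) =
    ∷-cong refl (≈⟦lowerCoeffs⟧ m xs (lead , λ i le → vanish (suc i) (s≤s le)))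

  ⟦⟧-injective : ∀ {d} (v w : Monic 𝔽 d) → ⟦ v ⟧ ≈ ⟦ w ⟧ → v ≡ w
  ⟦⟧-injective []ᵥ       []ᵥ       e = refl
  ⟦⟧-injective (x ∷ᵥ v) (y ∷ᵥ w) e = cong₂ _∷ᵥ_ (e .at 0) (⟦⟧-injective v w (≈-tail e))

  IsMonic-unique : ∀ a b p → IsMonic a p → IsMonic b p → a ≡ b
  IsMonic-unique a b p (lead-a , vanish-a) (lead-b , vanish-b) with ℕₚ.<-cmp a b
  ... | tri< a<b _ _ = ⊥-elim (0≢1 (trans (sym (vanish-a b a<b)) lead-b))
  ... | tri≈ _ a≡b _ = a≡b
  ... | tri> _ _ b<a = ⊥-elim (0≢1 (trans (sym (vanish-b a b<a)) lead-a))

  IsMonic-resp-≈ : ∀ {m p r} → p ≈ r → IsMonic m p → IsMonic m r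
  IsMonic-resp-≈ {m} e (lead , vanish) = trans (sym (e .at m)) lead , λ i le → trans (sym (e .at i)) (vanish i le)

  monics : (d : ℕ) → List (Monic 𝔽 d)
  monics = 𝓜 𝔽

  Σ-tabulate : ∀ n {m} (f : Fin n → Fin m) (h : Fin m → ℕ) →
    Σ[ tabulate f ] h ≡ Σ[ tabulate {n = n} (λ i → i) ] (λ i → h (f i))
  Σ-tabulate zero    f h = refl
  Σ-tabulate (suc n) f h = cong (h (f fzero) +_) (trans (Σ-tabulate n (λ i → f (fsuc i)) h) (sym (Σ-tabulate n fsuc (λ i → h (f i)))))

  Σ-allFin-single : ∀ n (h : Fin n → ℕ) y → (∀ x → ¬ x ≡ y → h x ≡ 0) → Σ[ allFin n ] h ≡ h y
  Σ-allFin-single (suc n) h fzero others =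
    trans (cong (h fzero +_) (trans (Σ-tabulate n fsuc h) (trans (Σ-cong (allFin n) (λ x → others (fsuc x) (λ ()))) (Σ-0 (allFin n)))))
          (ℕₚ.+-identityʳ _)
  Σ-allFin-single (suc n) h (fsuc y) others =
    cong₂ _+_ (others fzero (λ ()))
      (trans (Σ-tabulate n fsuc h) (Σ-allFin-single n (λ x → h (fsuc x)) y (λ x x≢y → others (fsuc x) (λ e → x≢y (Finₚ.suc-injective e)))))

  Σ-allFin-const : ∀ n c → Σ[ allFin n ] (λ _ → c) ≡ c * n
  Σ-allFin-const n c = trans (Σ-const (allFin n) c) (cong (c *_) (length-tabulate {n = n} (λ i → i)))

  Σmonics-suc : ∀ d (g : Monic 𝔽 (suc d) → ℕ) → Σ[ monics (suc d) ] g ≡ Σ[ allFin q ] (λ x → Σ[ monics d ] (λ v → g (x ∷ᵥ v)))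
  Σmonics-suc d g = trans (Σ-concatMap (allFin q) (λ x → map (x ∷ᵥ_) (monics d)) g) (Σ-cong (allFin q) (λ x → Σ-map (monics d) (x ∷ᵥ_) g))

  Σmonics-const : ∀ d c → Σ[ monics d ] (λ _ → c) ≡ c * q ^ d
  Σmonics-const zero    c = trans (ℕₚ.+-identityʳ c) (sym (ℕₚ.*-identityʳ c))
  Σmonics-const (suc d) c = begin
    Σ[ monics (suc d) ] (λ _ → c)                 ≡⟨ Σmonics-suc d (λ _ → c) ⟩
    Σ[ allFin q ] (λ x → Σ[ monics d ] (λ v → c)) ≡⟨ Σ-cong (allFin q) (λ x → Σmonics-const d c) ⟩
    Σ[ allFin q ] (λ x → c * q ^ d)          ≡⟨ Σ-allFin-const q (c * q ^ d) ⟩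
    c * q ^ d * q                            ≡⟨ ℕₚ.*-assoc c (q ^ d) q ⟩
    c * (q ^ d * q)                          ≡⟨ cong (c *_) (ℕₚ.*-comm (q ^ d) q) ⟩
    c * q ^ suc d                            ∎

  Σmonics-single : ∀ d (w : Monic 𝔽 d) (g : Monic 𝔽 d → ℕ) → (∀ v → ¬ v ≡ w → g v ≡ 0) → Σ[ monics d ] g ≡ g w
  Σmonics-single zero    []ᵥ       g others = ℕₚ.+-identityʳ _
  Σmonics-single (suc d) (y ∷ᵥ w) g others = begin
    Σ[ monics (suc d) ] g                                  ≡⟨ Σmonics-suc d g ⟩
    Σ[ allFin q ] (λ x → Σ[ monics d ] (λ v → g (x ∷ᵥ v)))
      ≡⟨ Σ-allFin-single q _ y (λ x x≢y → trans (Σ-cong (monics d) (λ v → others (x ∷ᵥ v) (λ e → x≢y (Vecₚ.∷-injectiveˡ e)))) (Σ-0 (monics d))) ⟩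
    Σ[ monics d ] (λ v → g (y ∷ᵥ v))
      ≡⟨ Σmonics-single d w (λ v → g (y ∷ᵥ v)) (λ v v≢w → others (y ∷ᵥ v) (λ e → v≢w (Vecₚ.∷-injectiveʳ e))) ⟩
    g (y ∷ᵥ w)                                        ∎

  ≤-Σmonics : ∀ d (w : Monic 𝔽 d) (g : Monic 𝔽 d → ℕ) → g w ≤ Σ[ monics d ] g
  ≤-Σmonics d w g = subst (_≤ Σ[ monics d ] g) (trans (Σmonics-single d w gʷ others) (gʷ-w (w ≟ᵛ w))) (Σ-mono-≤ (monics d) gʷ≤g)
    where
    _≟ᵛ_ : (v w : Monic 𝔽 d) → Dec (v ≡ w)
    _≟ᵛ_ = Vecₚ.≡-dec _≟ᶠ_
    gʷ : Monic 𝔽 d → ℕ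
    gʷ v with v ≟ᵛ w
    ... | yes _ = g v
    ... | no  _ = 0
    others : ∀ v → ¬ v ≡ w → gʷ v ≡ 0
    others v v≢w with v ≟ᵛ w
    ... | yes v≡w = ⊥-elim (v≢w v≡w)
    ... | no  _   = refl
    gʷ≤g : ∀ v → gʷ v ≤ g v
    gʷ≤g v with v ≟ᵛ w
    ... | yes _ = ℕₚ.≤-refl
    ... | no  _ = z≤n
    gʷ-w : Dec (w ≡ w) → gʷ w ≡ g w
    gʷ-w _ with w ≟ᵛ w
    ... | yes _   = refl
    ... | no  w≢w = ⊥-elim (w≢w refl)

  Σmonics-find : ∀ d p → IsMonic d p → (g : Monic 𝔽 d → ℕ) → Σ[ monics d ] (λ f → [ p == ⟦ f ⟧ ]ᵇ * g f) ≡ g (lowerCoeffs d p)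
  Σmonics-find d p mp g =
    trans (Σmonics-single d (lowerCoeffs d p) _ others)
          (trans (cong (_* g (lowerCoeffs d p)) ([==]ᵇ≡1 p _ (≈⟦lowerCoeffs⟧ d p mp))) (ℕₚ.+-identityʳ _))
    where
    others : ∀ v → ¬ v ≡ lowerCoeffs d p → [ p == ⟦ v ⟧ ]ᵇ * g v ≡ 0
    others v v≢p = cong (_* g v) ([==]ᵇ≡0 p ⟦ v ⟧ (λ e → v≢p (⟦⟧-injective v (lowerCoeffs d p) (≈-trans (≈-sym e) (≈⟦lowerCoeffs⟧ d p mp)))))

  Σmonics-none : ∀ e d p → IsMonic e p → ¬ e ≡ d → (g : Monic 𝔽 d → ℕ) → Σ[ monics d ] (λ f → [ p == ⟦ f ⟧ ]ᵇ * g f) ≡ 0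
  Σmonics-none e d p mp e≢d g = trans (Σ-cong (monics d) (λ v → cong (_* g v) ([==]ᵇ≡0 p ⟦ v ⟧ (λ eq →
    e≢d (IsMonic-unique e d p mp (IsMonic-resp-≈ (≈-sym eq) (⟦⟧-monic v))))))) (Σ-0 (monics d))

  -- The short-interval condition |f − A| ≤ q^h

  private
    absDeg : ℕ → ℕ
    absDeg zero    = 0
    absDeg (suc d) = q ^ d

    absP≡absDeg : ∀ p → absP 𝔽 p ≡ absDeg (length (normalize 𝔽 p))
    absP≡absDeg p with length (normalize 𝔽 p)
    ... | zero  = refl
    ... | suc d = refl

    coeff-length : ∀ (l : Pol) i → length l ≤ i → coeff l i ≡ 0F
    coeff-length []       i       _         = refl
    coeff-length (x ∷ xs) (suc i) (s≤s le) = coeff-length xs i le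

    Normal-last : ∀ (l : Pol) d → Normal l → length l ≡ suc d → ¬ coeff l d ≡ 0F
    Normal-last (x ∷ [])     zero    nl _  = nl
    Normal-last (x ∷ y ∷ ys) (suc d) nl eq = Normal-last (y ∷ ys) d nl (ℕₚ.suc-injective eq)

    T⇒≡true : ∀ b → Data.Bool.T b → b ≡ true
    T⇒≡true true _ = refl

    ≤ᵇ-false : ∀ m n → n < m → (m ≤ᵇ n) ≡ false
    ≤ᵇ-false m n n<m with m ≤ᵇ n in eq
    ... | true  = ⊥-elim (ℕₚ.<⇒≱ n<m (ℕₚ.≤ᵇ⇒≤ m n (subst Data.Bool.T (sym eq) tt)))
    ... | false = refl

  absP≤q^ : ∀ p h → VanishesFrom p (suc h) → (absP 𝔽 p ≤ᵇ q ^ h) ≡ true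
  absP≤q^ p h vanish rewrite absP≡absDeg p with length (normalize 𝔽 p) in eq
  ... | zero  = refl
  ... | suc d = T⇒≡true _ (ℕₚ.≤⇒≤ᵇ (q^-mono-≤ d≤h))
    where
    d≤h : d ≤ h
    d≤h = ℕₚ.≮⇒≥ (λ h<d → Normal-last (normalize 𝔽 p) d (Normal-normalize p) eq (trans (coeff-normalize p d) (vanish d h<d)))

  absP>q^ : ∀ p h m → ¬ coeff p m ≡ 0F → h < m → (absP 𝔽 p ≤ᵇ q ^ h) ≡ false
  absP>q^ p h m pₘ≢0 h<m rewrite absP≡absDeg p with length (normalize 𝔽 p) in eq
  ... | zero  = ⊥-elim (pₘ≢0 (trans (sym (coeff-normalize p m)) (coeff-length (normalize 𝔽 p) m (subst (_≤ m) (sym eq) z≤n))))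
  ... | suc d = ≤ᵇ-false (q ^ d) (q ^ h) (ℕₚ.^-monoʳ-< q 2≤q (ℕₚ.<-≤-trans h<m m≤d))
    where
    m≤d : m ≤ d
    m≤d = ℕₚ.≮⇒≥ (λ d<m → pₘ≢0 (trans (sym (coeff-normalize p m)) (coeff-length (normalize 𝔽 p) m (subst (_≤ m) (sym eq) d<m))))

  agreeFrom : ∀ {d} → ℕ → Monic 𝔽 d → Monic 𝔽 d → Bool
  agreeFrom m       []ᵥ       []ᵥ       = true
  agreeFrom zero    (x ∷ᵥ v) (y ∷ᵥ w) = does (x ≟ᶠ y) ∧ agreeFrom zero v w
  agreeFrom (suc m) (x ∷ᵥ v) (y ∷ᵥ w) = agreeFrom m v w

  agreeFrom-true : ∀ {d} m (v w : Monic 𝔽 d) → agreeFrom m v w ≡ true → ∀ i → m ≤ i → coeff ⟦ v ⟧ i ≡ coeff ⟦ w ⟧ i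
  agreeFrom-true m       []ᵥ       []ᵥ       _ i _ = refl
  agreeFrom-true zero    (x ∷ᵥ v) (y ∷ᵥ w) e i _ with x ≟ᶠ y
  agreeFrom-true zero    (x ∷ᵥ v) (y ∷ᵥ w) e zero    _ | yes x≡y = x≡y
  agreeFrom-true zero    (x ∷ᵥ v) (y ∷ᵥ w) e (suc i) _ | yes _   = agreeFrom-true zero v w e i z≤n
  agreeFrom-true (suc m) (x ∷ᵥ v) (y ∷ᵥ w) e (suc i) (s≤s le) = agreeFrom-true m v w e i le

  agreeFrom-false : ∀ {d} m (v w : Monic 𝔽 d) → agreeFrom m v w ≡ false →
    Σ ℕ λ i → m ≤ i × ¬ coeff ⟦ v ⟧ i ≡ coeff ⟦ w ⟧ i
  agreeFrom-false m []ᵥ []ᵥ ()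
  agreeFrom-false zero (x ∷ᵥ v) (y ∷ᵥ w) e with x ≟ᶠ y
  ... | no x≢y = 0 , z≤n , x≢y
  ... | yes _ with agreeFrom-false zero v w e
  ...   | i , _ , vᵢ≢wᵢ = suc i , z≤n , vᵢ≢wᵢ
  agreeFrom-false (suc m) (x ∷ᵥ v) (y ∷ᵥ w) e with agreeFrom-false m v w e
  ... | i , m≤i , vᵢ≢wᵢ = suc i , s≤s m≤i , vᵢ≢wᵢ

  Σmonics-agreeFrom : ∀ d m (v : Monic 𝔽 d) → m ≤ d → Σ[ monics d ] (λ w → [ agreeFrom m v w ]ᵇ) ≡ q ^ m
  Σmonics-agreeFrom zero    zero    []ᵥ       _ = refl
  Σmonics-agreeFrom (suc d) zero    (x ∷ᵥ v) _ = begin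
    Σ[ monics (suc d) ] (λ w → [ agreeFrom zero (x ∷ᵥ v) w ]ᵇ)
      ≡⟨ Σmonics-suc d _ ⟩
    Σ[ allFin q ] (λ y → Σ[ monics d ] (λ w → [ does (x ≟ᶠ y) ∧ agreeFrom zero v w ]ᵇ))
      ≡⟨ Σ-cong (allFin q) (λ y → trans (Σ-cong (monics d) (λ w → [∧]ᵇ (does (x ≟ᶠ y)) (agreeFrom zero v w)))
           (trans (Σ-*ˡ (monics d) [ does (x ≟ᶠ y) ]ᵇ (λ w → [ agreeFrom zero v w ]ᵇ)) (cong ([ does (x ≟ᶠ y) ]ᵇ *_) (Σmonics-agreeFrom d zero v z≤n)))) ⟩
    Σ[ allFin q ] (λ y → [ does (x ≟ᶠ y) ]ᵇ * 1)
      ≡⟨ Σ-allFin-single q _ x (λ y y≢x → cong (λ b → [ b ]ᵇ * 1) (dec-false (x ≟ᶠ y) (λ e → y≢x (sym e)))) ⟩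
    [ does (x ≟ᶠ x) ]ᵇ * 1
      ≡⟨ cong (λ b → [ b ]ᵇ * 1) (dec-true (x ≟ᶠ x) refl) ⟩
    1 ∎
  Σmonics-agreeFrom (suc d) (suc m) (x ∷ᵥ v) (s≤s m≤d) = begin
    Σ[ monics (suc d) ] (λ w → [ agreeFrom (suc m) (x ∷ᵥ v) w ]ᵇ)    ≡⟨ Σmonics-suc d _ ⟩
    Σ[ allFin q ] (λ y → Σ[ monics d ] (λ w → [ agreeFrom m v w ]ᵇ)) ≡⟨ Σ-cong (allFin q) (λ y → Σmonics-agreeFrom d m v m≤d) ⟩
    Σ[ allFin q ] (λ y → q ^ m)                                  ≡⟨ Σ-allFin-const q (q ^ m) ⟩
    q ^ m * q                                                   ≡⟨ ℕₚ.*-comm (q ^ m) q ⟩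
    q ^ suc m                                                   ∎

  private
    bool-ext : ∀ b₁ b₂ → (b₂ ≡ true → b₁ ≡ true) → (b₂ ≡ false → b₁ ≡ false) → b₁ ≡ b₂
    bool-ext b₁ true  t f = t refl
    bool-ext b₁ false t f = f refl

  near⇔agreeFrom : ∀ n h (f A : Monic 𝔽 n) → (absP 𝔽 (⟦ f ⟧ ⊖ ⟦ A ⟧) ≤ᵇ q ^ h) ≡ agreeFrom (suc h) f A
  near⇔agreeFrom n h f A = bool-ext _ _
    (λ agree → absP≤q^ (⟦ f ⟧ ⊖ ⟦ A ⟧) h (λ i h<i →
       trans (coeff-⊖ ⟦ f ⟧ ⟦ A ⟧ i) (trans (cong (_−ᶠ coeff ⟦ A ⟧ i) (agreeFrom-true (suc h) f A agree i h<i)) (-‿inverseʳ _))))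
    (λ disagree → case (agreeFrom-false (suc h) f A disagree))
    where
    case : Σ ℕ (λ i → suc h ≤ i × ¬ coeff ⟦ f ⟧ i ≡ coeff ⟦ A ⟧ i) → (absP 𝔽 (⟦ f ⟧ ⊖ ⟦ A ⟧) ≤ᵇ q ^ h) ≡ false
    case (i , h<i , fᵢ≢Aᵢ) = absP>q^ (⟦ f ⟧ ⊖ ⟦ A ⟧) h i (λ z → fᵢ≢Aᵢ (x∙y⁻¹≈ε⇒x≈y _ _ (trans (sym (coeff-⊖ ⟦ f ⟧ ⟦ A ⟧ i)) z))) h<i

  near-lowDegree : ∀ d n h (f : Monic 𝔽 d) (A : Monic 𝔽 n) → d < n → h < n → (absP 𝔽 (⟦ f ⟧ ⊖ ⟦ A ⟧) ≤ᵇ q ^ h) ≡ false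
  near-lowDegree d n h f A d<n h<n = absP>q^ (⟦ f ⟧ ⊖ ⟦ A ⟧) h n fₙ−Aₙ≢0 h<n
    where
    fₙ−Aₙ≢0 : ¬ coeff (⟦ f ⟧ ⊖ ⟦ A ⟧) n ≡ 0F
    fₙ−Aₙ≢0 z = 0≢1 (x∙y⁻¹≈ε⇒x≈y _ _ (trans (cong (_−ᶠ 1F) (sym (proj₂ (⟦⟧-monic f) n d<n)))
                   (trans (cong (coeff ⟦ f ⟧ n −ᶠ_) (sym (proj₁ (⟦⟧-monic A)))) (trans (sym (coeff-⊖ ⟦ f ⟧ ⟦ A ⟧ n)) z))))

  nonvanishingAt0 : ∀ {d} → Monic 𝔽 d → Bool
  nonvanishingAt0 f = not (isZero (eval0 𝔽 ⟦ f ⟧))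

  total𝓝U≡q^[h+1]*SΛ : ∀ k n h → suc h < n → total𝓝U 𝔽 k n h ≡ q ^ suc h * SΛ 𝔽 k n
  total𝓝U≡q^[h+1]*SΛ k n h 1+h<n = begin
    Σ[ monics n ] (λ A → 𝓝U 𝔽 k n h A)                      ≡⟨ Σ-cong (monics n) only-degree-n ⟩
    Σ[ monics n ] (λ A → Σ[ monics n ] (λ f → [ agreeFrom (suc h) f A ]ᵇ * w f))  ≡⟨ Σ-comm (monics n) (monics n) _ ⟩
    Σ[ monics n ] (λ f → Σ[ monics n ] (λ A → [ agreeFrom (suc h) f A ]ᵇ * w f))
      ≡⟨ Σ-cong (monics n) (λ f → trans (Σ-*ʳ (monics n) (w f) (λ A → [ agreeFrom (suc h) f A ]ᵇ))
                                         (cong (_* w f) (Σmonics-agreeFrom n (suc h) f (ℕₚ.<⇒≤ 1+h<n)))) ⟩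
    Σ[ monics n ] (λ f → q ^ suc h * w f)                  ≡⟨ Σ-*ˡ (monics n) (q ^ suc h) w ⟩
    q ^ suc h * SΛ 𝔽 k n                                    ∎
    where
    h<n : h < n
    h<n = ℕₚ.<-trans (ℕₚ.n<1+n h) 1+h<n
    w : Monic 𝔽 n → ℕ
    w f = [ nonvanishingAt0 f ]ᵇ * Λ[_] 𝔽 k n f
    term : ∀ {d} → Monic 𝔽 d → Monic 𝔽 n → ℕ
    term {d} f A = [ (absP 𝔽 (⟦ f ⟧ ⊖ ⟦ A ⟧) ≤ᵇ q ^ h) ∧ nonvanishingAt0 f ]ᵇ * Λ[_] 𝔽 k d f
    term-n : ∀ A f → term f A ≡ [ agreeFrom (suc h) f A ]ᵇ * w f
    term-n A f = trans (cong (_* Λ[_] 𝔽 k n f) (trans (cong (λ b → [ b ∧ nonvanishingAt0 f ]ᵇ) (near⇔agreeFrom n h f A))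
                                                       ([∧]ᵇ (agreeFrom (suc h) f A) (nonvanishingAt0 f))))
                       (ℕₚ.*-assoc [ agreeFrom (suc h) f A ]ᵇ [ nonvanishingAt0 f ]ᵇ (Λ[_] 𝔽 k n f))
    term-low : ∀ A d → d < n → Σ[ monics d ] (λ f → term f A) ≡ 0
    term-low A d d<n = trans (Σ-cong (monics d) (λ f → cong (λ b → [ b ∧ nonvanishingAt0 f ]ᵇ * Λ[_] 𝔽 k d f) (near-lowDegree d n h f A d<n h<n)))
                             (Σ-0 (monics d))
    only-degree-n : ∀ A → 𝓝U 𝔽 k n h A ≡ Σ[ monics n ] (λ f → [ agreeFrom (suc h) f A ]ᵇ * w f)
    only-degree-n A = begin
      𝓝U 𝔽 k n h A                                               ≡⟨ Σ-range0 n _ ⟩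
      sumTo n (λ d → Σ[ monics d ] (λ f → term f A)) + Σ[ monics n ] (λ f → term f A)
        ≡⟨ cong₂ _+_ (sumTo-0 n (term-low A)) (Σ-cong (monics n) (term-n A)) ⟩
      0 + Σ[ monics n ] (λ f → [ agreeFrom (suc h) f A ]ᵇ * w f) ≡⟨⟩
      Σ[ monics n ] (λ f → [ agreeFrom (suc h) f A ]ᵇ * w f)     ∎

  -- Degrees, cancellation and division by monic polynomials

  Degree : Pol → Set
  Degree p = Σ ℕ λ k → (¬ coeff p k ≡ 0F) × VanishesFrom p (suc k)

  ≈[]⊎Degree : ∀ p → p ≈ [] ⊎ Degree p
  ≈[]⊎Degree []       = inj₁ ≈-refl
  ≈[]⊎Degree (x ∷ xs) with ≈[]⊎Degree xs
  ... | inj₂ (k , lead≢0 , vanish) = inj₂ (suc k , lead≢0 , λ { (suc i) (s≤s le) → vanish i le })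
  ... | inj₁ xs≈[] with x ≟ᶠ 0F
  ...   | yes x≡0 = inj₁ (mk≈ λ { zero → x≡0 ; (suc i) → xs≈[] .at i })
  ...   | no  x≢0 = inj₂ (0 , x≢0 , λ { (suc i) _ → xs≈[] .at i })

  ⊗-top-coeff : ∀ p m k r → VanishesFrom p (suc m) → VanishesFrom r (suc k) →
    (coeff (p ⊗ r) (m + k) ≡ coeff p m *ᶠ coeff r k) × VanishesFrom (p ⊗ r) (suc (m + k))
  ⊗-top-coeff []       m       k r vp vr = sym (zeroˡ _) , λ i _ → refl
  ⊗-top-coeff (x ∷ xs) zero    k r vp vr =
    trans (coeff-∷-⊗ x xs r k) (trans (cong (x *ᶠ coeff r k +ᶠ_) (shifted k)) (+-identityʳ _)) ,
    λ i le → trans (coeff-∷-⊗ x xs r i) (trans (cong₂ _+ᶠ_ (trans (cong (x *ᶠ_) (vr i le)) (zeroʳ x)) (shifted i)) (+-identityʳ 0F))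
    where
    shifted : ∀ i → coeff (0F ∷ (xs ⊗ r)) i ≡ 0F
    shifted zero    = refl
    shifted (suc i) = ⊗-zeroˡ xs r (mk≈ λ j → vp (suc j) (s≤s z≤n)) .at i
  ⊗-top-coeff (x ∷ xs) (suc m) k r vp vr =
    trans (coeff-∷-⊗ x xs r (suc (m + k))) (trans (cong₂ _+ᶠ_ (x*r≡0 (ℕₚ.m≤n+m k m)) (proj₁ ih)) (+-identityˡ _)) ,
    λ { (suc i) (s≤s le) → trans (coeff-∷-⊗ x xs r (suc i))
          (trans (cong₂ _+ᶠ_ (x*r≡0 (ℕₚ.≤-trans (ℕₚ.m≤n+m k m) (ℕₚ.≤-trans (ℕₚ.n≤1+n _) le))) (proj₂ ih i le)) (+-identityˡ 0F)) }
    where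
    ih = ⊗-top-coeff xs m k r (λ i le → vp (suc i) (s≤s le)) vr
    x*r≡0 : ∀ {i} → k ≤ i → x *ᶠ coeff r (suc i) ≡ 0F
    x*r≡0 k≤i = trans (cong (x *ᶠ_) (vr _ (s≤s k≤i))) (zeroʳ x)

  IsMonic-⊗ : ∀ m k p r → IsMonic m p → IsMonic k r → IsMonic (m + k) (p ⊗ r)
  IsMonic-⊗ m k p r (lead-p , vp) (lead-r , vr) with ⊗-top-coeff p m k r vp vr
  ... | top , vanish = trans top (trans (cong₂ _*ᶠ_ lead-p lead-r) (*-identityˡ 1F)) , vanish

  IsMonic-⊗-degree : ∀ m k D t → IsMonic m D → ¬ coeff t k ≡ 0F → VanishesFrom t (suc k) →
    (¬ coeff (D ⊗ t) (m + k) ≡ 0F) × VanishesFrom (D ⊗ t) (suc (m + k))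
  IsMonic-⊗-degree m k D t (lead , vD) t≢0 vt with ⊗-top-coeff D m k t vD vt
  ... | top , vanish = (λ e → t≢0 (trans (sym (*-identityˡ _)) (trans (cong (_*ᶠ coeff t k) (sym lead)) (trans (sym top) e)))) , vanish

  IsMonic-⊗-≉[] : ∀ m D t → IsMonic m D → ¬ t ≈ [] → ¬ D ⊗ t ≈ []
  IsMonic-⊗-≉[] m D t mD t≉[] Dt≈[] with ≈[]⊎Degree t
  ... | inj₁ t≈[]                = t≉[] t≈[]
  ... | inj₂ (k , lead≢0 , vanish) = proj₁ (IsMonic-⊗-degree m k D t mD lead≢0 vanish) (Dt≈[] .at (m + k))

  IsMonic-⊗-cancelˡ : ∀ m D a b → IsMonic m D → D ⊗ a ≈ D ⊗ b → a ≈ b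
  IsMonic-⊗-cancelˡ m D a b mD e with ≈[]⊎Degree (a ⊖ b)
  ... | inj₁ a−b≈[]        = ⊖≈[]⇒≈ a b a−b≈[]
  ... | inj₂ (k , lead≢0 , _) = ⊥-elim (IsMonic-⊗-≉[] m D (a ⊖ b) mD (λ z → lead≢0 (z .at k))
                                   (≈-trans (⊗-distrib-⊖ˡ D a b) (≈⇒⊖≈[] _ _ e)))

  infix 4 _∣_
  _∣_ : Pol → Pol → Set
  d ∣ p = Σ Pol λ s → p ≈ d ⊗ s

  ∣-resp-≈ : ∀ {d p p′} → p ≈ p′ → d ∣ p → d ∣ p′
  ∣-resp-≈ e (s , eq) = s , ≈-trans (≈-sym e) eq

  IsMonic-cofactor : ∀ e m P a b → IsMonic e P → IsMonic m a → P ≈ a ⊗ b → (m ≤ e) × IsMonic (e ∸ m) b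
  IsMonic-cofactor e m P a b (lead-P , vP) ma eq with ≈[]⊎Degree b
  ... | inj₁ b≈[] = ⊥-elim (0≢1 (trans (sym (trans (eq .at e) (trans (⊗-congʳ a b≈[] .at e) (⊗-zeroʳ a .at e)))) lead-P))
  ... | inj₂ (k , lead≢0 , vb) with IsMonic-⊗-degree m k a b ma lead≢0 vb
  ...   | ab-lead≢0 , vab with ℕₚ.<-cmp e (m + k)
  ...     | tri< e<m+k _ _ = ⊥-elim (ab-lead≢0 (trans (sym (eq .at (m + k))) (vP (m + k) e<m+k)))
  ...     | tri> _ _ m+k<e = ⊥-elim (0≢1 (trans (sym (trans (eq .at e) (vab e m+k<e))) lead-P))
  ...     | tri≈ _ refl _  = ℕₚ.m≤m+n m k , subst (λ z → IsMonic z b) (sym (ℕₚ.m+n∸m≡n m k)) (lead-b , vb)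
    where
    lead-b : coeff b k ≡ 1F
    lead-b = trans (sym (*-identityˡ _)) (trans (cong (_*ᶠ coeff b k) (sym (proj₁ ma)))
               (trans (sym (proj₁ (⊗-top-coeff a m k b (proj₂ ma) vb))) (trans (sym (eq .at (m + k))) lead-P)))

  DivisionWithRemainder : Pol → ℕ → Pol → Set
  DivisionWithRemainder D e p = Σ Pol λ s → Σ Pol λ t → (p ≈ D ⊗ s ⊕ t) × VanishesFrom t e

  -- long division, one coefficient of p at a time from the top: x ∷ xs = T·(D s′ + t′) + x
  -- and the T^(e+1)-coefficient c of T·t′ is removed by subtracting c·D
  divide : ∀ e D → IsMonic e D → ∀ p → DivisionWithRemainder D e p
  divide zero    D mD p = p , [] , ≈-sym p≈Dp , λ i _ → refl
    where
    p≈Dp : D ⊗ p ⊕ [] ≈ p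
    p≈Dp = ≈-trans (⊕-identityʳ (D ⊗ p)) (≈-trans (⊗-comm D p) (≈-trans (⊗-congʳ p (≈⟦lowerCoeffs⟧ 0 D mD)) (⊗-identityʳ p)))
  divide (suc e) D mD [] = [] , [] , ≈-sym (≈-trans (⊕-identityʳ (D ⊗ [])) (⊗-zeroʳ D)) , λ i _ → refl
  divide (suc e) D (lead , vD) (x ∷ xs) with divide (suc e) D (lead , vD) xs
  ... | s′ , t′ , xs≈Ds′+t′ , vt′ = s , t , p≈Ds+t , vt
    where
    c = coeff t′ e
    u = x ∷ t′
    s = (0F ∷ s′) ⊕ (c ∷ [])
    t = u ⊖ c · D
    vt : VanishesFrom t (suc e)
    vt i le with ℕₚ.m≤n⇒m<n∨m≡n le
    ... | inj₂ refl = trans (coeff-⊖ u (c · D) (suc e))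
                        (trans (cong (c −ᶠ_) (trans (coeff-· c D (suc e)) (trans (cong (c *ᶠ_) lead) (*-identityʳ c)))) (-‿inverseʳ c))
    ... | inj₁ lt   = trans (coeff-⊖ u (c · D) i)
                        (trans (cong₂ _−ᶠ_ (vu i lt) (trans (coeff-· c D i) (trans (cong (c *ᶠ_) (vD i lt)) (zeroʳ c)))) (-‿inverseʳ 0F))
      where
      vu : ∀ i → suc (suc e) ≤ i → coeff u i ≡ 0F
      vu (suc i) (s≤s le) = vt′ i le
    Ds≈ : D ⊗ s ≈ (0F ∷ (D ⊗ s′)) ⊕ c · D
    Ds≈ = ≈-trans (⊗-distribˡ D (0F ∷ s′) (c ∷ []))
            (⊕-cong (≈-trans (⊗-comm D (0F ∷ s′)) (≈-trans (0∷-⊗ s′ D) (∷-cong refl (⊗-comm s′ D))))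
                    (≈-trans (⊗-comm D (c ∷ [])) ([c]⊗ c D)))
    cancel-c : ∀ a b w → (a +ᶠ b) +ᶠ (w −ᶠ b) ≡ a +ᶠ w
    cancel-c a b w = trans (+-interchange a b w (-ᶠ b)) (trans (cong ((a +ᶠ w) +ᶠ_) (-‿inverseʳ b)) (+-identityʳ _))
    low : ∀ i → coeff (0F ∷ (D ⊗ s′)) i +ᶠ coeff u i ≡ coeff (x ∷ xs) i
    low zero    = +-identityˡ x
    low (suc i) = trans (sym (coeff-⊕ (D ⊗ s′) t′ i)) (sym (xs≈Ds′+t′ .at i))
    p≈Ds+t : (x ∷ xs) ≈ D ⊗ s ⊕ t
    p≈Ds+t = mk≈ λ i → sym (begin
      coeff (D ⊗ s ⊕ t) i                                    ≡⟨ coeff-⊕ (D ⊗ s) t i ⟩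
      coeff (D ⊗ s) i +ᶠ coeff t i                           ≡⟨ cong₂ _+ᶠ_ (trans (Ds≈ .at i) (coeff-⊕ (0F ∷ (D ⊗ s′)) (c · D) i)) (coeff-⊖ u (c · D) i) ⟩
      (coeff (0F ∷ (D ⊗ s′)) i +ᶠ coeff (c · D) i) +ᶠ (coeff u i −ᶠ coeff (c · D) i) ≡⟨ cancel-c _ _ _ ⟩
      coeff (0F ∷ (D ⊗ s′)) i +ᶠ coeff u i                   ≡⟨ low i ⟩
      coeff (x ∷ xs) i                                       ∎)

  remainder-∤ : ∀ e D t → IsMonic e D → VanishesFrom t e → ¬ t ≈ [] → ∀ w → ¬ t ≈ D ⊗ w
  remainder-∤ e D t mD vt t≉[] w eq with ≈[]⊎Degree w
  ... | inj₁ w≈[] = t≉[] (≈-trans eq (≈-trans (⊗-congʳ D w≈[]) (⊗-zeroʳ D)))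
  ... | inj₂ (k , lead≢0 , vw) = proj₁ (IsMonic-⊗-degree e k D w mD lead≢0 vw) (trans (sym (eq .at (e + k))) (vt (e + k) (ℕₚ.m≤m+n e k)))

  remainder≈ : ∀ p x t → p ≈ x ⊕ t → t ≈ p ⊖ x
  remainder≈ p x t e = mk≈ λ i →
    trans (x+y≡z⇒y≡z−x (coeff x i) (coeff t i) (coeff p i) (trans (sym (coeff-⊕ x t i)) (sym (e .at i)))) (sym (coeff-⊖ p x i))

  ∣? : ∀ e D → IsMonic e D → ∀ p → Dec (D ∣ p)
  ∣? e D mD p with divide e D mD p
  ... | s , t , p≈Ds+t , vt with ≈[]⊎Degree t
  ...   | inj₁ t≈[] = yes (s , ≈-trans p≈Ds+t (≈-trans (⊕-cong (≈-refl {D ⊗ s}) t≈[]) (⊕-identityʳ (D ⊗ s))))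
  ...   | inj₂ (k , lead≢0 , _) = no λ { (w , p≈Dw) → remainder-∤ e D t mD vt (λ z → lead≢0 (z .at k)) (w ⊖ s)
            (≈-trans (remainder≈ p (D ⊗ s) t p≈Ds+t) (≈-trans (⊖-cong p≈Dw ≈-refl) (≈-sym (⊗-distrib-⊖ˡ D w s)))) }

  Irreducible : ℕ → Pol → Set
  Irreducible e P = IsMonic e P × 1 ≤ e × (∀ m a b → IsMonic m a → P ≈ a ⊗ b → m ≡ 0 ⊎ m ≡ e)

  isIrreducible : (e : ℕ) → Monic 𝔽 e → Bool
  isIrreducible = irreducibleᵇ 𝔽

  factorisations : (e : ℕ) → Monic 𝔽 e → ℕ
  factorisations e P = Σ[ range1 e ] λ i → Σ[ monics i ] λ a → Σ[ monics (e ∸ i) ] λ b →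
                         [ (1 ≤ᵇ (e ∸ i)) ∧ (⟦ a ⟧ ⊗ ⟦ b ⟧ == ⟦ P ⟧) ]ᵇ

  private
    ≤ᵇ-true : ∀ k → 1 ≤ k → (1 ≤ᵇ k) ≡ true
    ≤ᵇ-true (suc k) _ = refl

    ≤ᵇ-sound : ∀ k → (1 ≤ᵇ k) ≡ true → 1 ≤ k
    ≤ᵇ-sound (suc k) _ = s≤s z≤n

    does-≟0 : ∀ n → does (n ℕₚ.≟ 0) ≡ true → n ≡ 0
    does-≟0 zero _ = refl

    ∧-true : ∀ a b → (a ∧ b) ≡ true → (a ≡ true) × (b ≡ true)
    ∧-true true true _ = refl , refl

    [_]ᵇ≢0 : ∀ b → ¬ [ b ]ᵇ ≡ 0 → b ≡ true
    [ true  ]ᵇ≢0 _   = refl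
    [ false ]ᵇ≢0 ne = ⊥-elim (ne refl)

  isIrreducible-sound : ∀ e v → isIrreducible e v ≡ true → Irreducible e ⟦ v ⟧
  isIrreducible-sound (suc e′) v noFactorisation = ⟦⟧-monic v , s≤s z≤n , trivial-factor
    where
    e = suc e′
    trivial-factor : ∀ m a b → IsMonic m a → ⟦ v ⟧ ≈ a ⊗ b → m ≡ 0 ⊎ m ≡ e
    trivial-factor m a b ma eq with IsMonic-cofactor e m ⟦ v ⟧ a b (⟦⟧-monic v) ma eq
    ... | m≤e , mb with m | ℕₚ.m≤n⇒m<n∨m≡n m≤e
    ... | zero   | _         = inj₁ refl
    ... | suc m′ | inj₂ m≡e  = inj₂ m≡e
    ... | suc m′ | inj₁ m<e  = ⊥-elim (ℕₚ.<⇒≱ (s≤s z≤n) (ℕₚ.≤-trans 1≤count (ℕₚ.≤-reflexive (does-≟0 _ noFactorisation))))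
      where
      k = e ∸ suc m′
      a′ = lowerCoeffs (suc m′) a
      b′ = lowerCoeffs k b
      F : ℕ → ℕ
      F i = Σ[ monics i ] λ a → Σ[ monics (e ∸ i) ] λ b → [ (1 ≤ᵇ (e ∸ i)) ∧ (⟦ a ⟧ ⊗ ⟦ b ⟧ == ⟦ v ⟧) ]ᵇ
      term≡1 : [ (1 ≤ᵇ k) ∧ (⟦ a′ ⟧ ⊗ ⟦ b′ ⟧ == ⟦ v ⟧) ]ᵇ ≡ 1
      term≡1 = trans (cong (λ z → [ z ∧ (⟦ a′ ⟧ ⊗ ⟦ b′ ⟧ == ⟦ v ⟧) ]ᵇ) (≤ᵇ-true k (ℕₚ.m<n⇒0<n∸m m<e)))
                     ([==]ᵇ≡1 _ _ (≈-sym (≈-trans eq (⊗-cong (≈⟦lowerCoeffs⟧ (suc m′) a ma) (≈⟦lowerCoeffs⟧ k b mb)))))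
      1≤count : 1 ≤ factorisations e v
      1≤count = ℕₚ.≤-trans (ℕₚ.≤-reflexive (sym term≡1))
        (ℕₚ.≤-trans (≤-Σmonics k b′ (λ b → [ (1 ≤ᵇ k) ∧ (⟦ a′ ⟧ ⊗ ⟦ b ⟧ == ⟦ v ⟧) ]ᵇ))
        (ℕₚ.≤-trans (≤-Σmonics (suc m′) a′ (λ a → Σ[ monics k ] λ b → [ (1 ≤ᵇ k) ∧ (⟦ a ⟧ ⊗ ⟦ b ⟧ == ⟦ v ⟧) ]ᵇ))
        (ℕₚ.≤-trans (≤-sumTo e (λ i → F (suc i)) m′ (ℕₚ.<-trans (ℕₚ.n<1+n m′) m<e)) (ℕₚ.≤-reflexive (sym (Σ-range1 e F))))))

  ¬isIrreducible⇒factors : ∀ d (v : Monic 𝔽 d) → 1 ≤ d → ¬ isIrreducible d v ≡ true →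
    Σ ℕ λ j → Σ (Monic 𝔽 (suc j)) λ a → Σ (Monic 𝔽 (d ∸ suc j)) λ b → (1 ≤ d ∸ suc j) × (⟦ a ⟧ ⊗ ⟦ b ⟧ ≈ ⟦ v ⟧)
  ¬isIrreducible⇒factors (suc d′) v _ reducible with factorisations (suc d′) v ℕₚ.≟ 0
  ... | yes count≡0 = ⊥-elim (reducible (cong (λ n → does (n ℕₚ.≟ 0)) count≡0))
  ... | no count≢0 with Σ≢0⇒∃ (upTo (suc d′)) _ (λ z → count≢0 (trans (Σ-map (upTo (suc d′)) suc _) z))
  ...   | j , j≢0 with Σ≢0⇒∃ (monics (suc j)) _ j≢0
  ...     | a , a≢0 with Σ≢0⇒∃ (monics (suc d′ ∸ suc j)) _ a≢0
  ...       | b , b≢0 with ∧-true _ _ ([ _ ]ᵇ≢0 b≢0)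
  ...         | 1≤k , ab≡v = j , a , b , ≤ᵇ-sound _ 1≤k , ==-sound _ _ ab≡v

  IrreducibleFactor : Pol → Set
  IrreducibleFactor f = Σ ℕ λ e → Σ (Monic 𝔽 e) λ Q → (isIrreducible e Q ≡ true) × Σ Pol λ f′ → f ≈ ⟦ Q ⟧ ⊗ f′

  -- the first argument bounds the degree and drives the recursion
  irreducibleFactor : ∀ N d (v : Monic 𝔽 d) → d < N → 1 ≤ d → IrreducibleFactor ⟦ v ⟧
  irreducibleFactor (suc N) d v d<N 1≤d with isIrreducible d v Data.Bool.≟ true
  ... | yes irr = d , v , irr , oneP 𝔽 , ≈-sym (⊗-identityʳ ⟦ v ⟧)
  ... | no red with ¬isIrreducible⇒factors d v 1≤d red
  ...   | j , a , b , 1≤k , ab≈v with irreducibleFactor N (suc j) a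
            (ℕₚ.<-≤-trans (ℕₚ.m∸n≢0⇒n<m (λ z → ℕₚ.<⇒≱ 1≤k (ℕₚ.≤-reflexive z))) (ℕₚ.≤-pred d<N)) (s≤s z≤n)
  ...     | e , Q , irr , a′ , a≈Qa′ =
              e , Q , irr , a′ ⊗ ⟦ b ⟧ , ≈-sym (≈-trans (≈-sym (⊗-assoc ⟦ Q ⟧ a′ ⟦ b ⟧)) (≈-trans (⊗-congˡ ⟦ b ⟧ (≈-sym a≈Qa′)) ab≈v))

  ⊗-⊗-comm : ∀ P s u → s ⊗ (P ⊗ u) ≈ P ⊗ (s ⊗ u)
  ⊗-⊗-comm P s u = ≈-trans (≈-sym (⊗-assoc s P u)) (≈-trans (⊗-congˡ u (⊗-comm s P)) (⊗-assoc P s u))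

  ·inv-monic : ∀ t k (t≢0 : ¬ coeff t k ≡ 0F) → VanishesFrom t (suc k) → IsMonic k (inv (coeff t k) t≢0 · t)
  ·inv-monic t k t≢0 vt = trans (coeff-· (inv (coeff t k) t≢0) t k) (inverseˡ _ t≢0) ,
    λ i le → trans (coeff-· (inv (coeff t k) t≢0) t i) (trans (cong (inv (coeff t k) t≢0 *ᶠ_) (vt i le)) (zeroʳ _))

  module _ (e : ℕ) (P : Pol) (irrP : Irreducible e P) where

    private
      -- P ∣ a b with a monic of degree < deg P forces P ∣ b: dividing P by a leaves a
      -- remainder of smaller degree that P still divides against b, unless a is constant.
      euclid-small : ∀ N m a b → m < N → IsMonic m a → m < e → P ∣ a ⊗ b → P ∣ b
      euclid-small (suc N) zero a b _ ma _ (u , ab≈Pu) =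
        u , ≈-trans (≈-sym (≈-trans (⊗-congˡ b (≈⟦lowerCoeffs⟧ 0 a ma)) (⊗-identityˡ b))) ab≈Pu
      euclid-small (suc N) (suc m′) a b (s≤s m<N) ma m<e (u , ab≈Pu) with divide (suc m′) a ma P
      ... | s , t , P≈as+t , vt with ≈[]⊎Degree t
      ...   | inj₁ t≈[] with proj₂ (proj₂ irrP) (suc m′) a s ma (≈-trans P≈as+t (≈-trans (⊕-cong (≈-refl {a ⊗ s}) t≈[]) (⊕-identityʳ (a ⊗ s))))
      ...     | inj₁ ()
      ...     | inj₂ m≡e = ⊥-elim (ℕₚ.<-irrefl m≡e m<e)
      euclid-small (suc N) (suc m′) a b (s≤s m<N) ma m<e (u , ab≈Pu) | s , t , P≈as+t , vt | inj₂ (k , t≢0 , vtk) =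
        euclid-small N k t′ b k<N (·inv-monic t k t≢0 vtk) (ℕₚ.<-trans k<m m<e) (c · (b ⊖ s ⊗ u) , t′b≈)
        where
        c = inv (coeff t k) t≢0
        t′ = c · t
        k<m : k < suc m′
        k<m = ℕₚ.≰⇒> (λ le → t≢0 (vt k le))
        k<N : k < N
        k<N = ℕₚ.<-≤-trans k<m m<N
        tb≈ : t ⊗ b ≈ P ⊗ (b ⊖ s ⊗ u)
        tb≈ = ≈-trans (⊗-congˡ b (remainder≈ P (a ⊗ s) t P≈as+t))
              (≈-trans (⊗-distrib-⊖ʳ P (a ⊗ s) b)
              (≈-trans (⊖-cong ≈-refl (≈-trans (⊗-congˡ b (⊗-comm a s)) (≈-trans (⊗-assoc s a b) (≈-trans (⊗-congʳ s ab≈Pu) (⊗-⊗-comm P s u)))))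
                       (≈-sym (⊗-distrib-⊖ˡ P b (s ⊗ u)))))
        t′b≈ : t′ ⊗ b ≈ P ⊗ c · (b ⊖ s ⊗ u)
        t′b≈ = ≈-trans (·-⊗ c t b) (≈-trans (·-congʳ c tb≈) (≈-sym (⊗-· c P _)))

    euclid : ∀ a b → P ∣ a ⊗ b → P ∣ a ⊎ P ∣ b
    euclid a b (u , ab≈Pu) with divide e P (proj₁ irrP) a
    ... | s , r , a≈Ps+r , vr with ≈[]⊎Degree r
    ...   | inj₁ r≈[] = inj₁ (s , ≈-trans a≈Ps+r (≈-trans (⊕-cong (≈-refl {P ⊗ s}) r≈[]) (⊕-identityʳ (P ⊗ s))))
    ...   | inj₂ (k , r≢0 , vrk) =
              inj₂ (euclid-small (suc k) k r′ b (ℕₚ.n<1+n k) (·inv-monic r k r≢0 vrk) k<e (c · (u ⊖ s ⊗ b) , r′b≈))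
      where
      c = inv (coeff r k) r≢0
      r′ = c · r
      k<e : k < e
      k<e = ℕₚ.≰⇒> (λ le → r≢0 (vr k le))
      rb≈ : r ⊗ b ≈ P ⊗ (u ⊖ s ⊗ b)
      rb≈ = ≈-trans (⊗-congˡ b (remainder≈ a (P ⊗ s) r a≈Ps+r))
            (≈-trans (⊗-distrib-⊖ʳ a (P ⊗ s) b)
            (≈-trans (⊖-cong ab≈Pu (⊗-assoc P s b)) (≈-sym (⊗-distrib-⊖ˡ P u (s ⊗ b)))))
      r′b≈ : r′ ⊗ b ≈ P ⊗ c · (u ⊖ s ⊗ b)
      r′b≈ = ≈-trans (·-⊗ c r b) (≈-trans (·-congʳ c rb≈) (≈-sym (⊗-· c P _)))

  Irreducible-∣⇒≈ : ∀ e e′ P Q → Irreducible e P → Irreducible e′ Q → P ∣ Q → P ≈ Q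
  Irreducible-∣⇒≈ e e′ P Q (mP , 1≤e , _) (mQ , _ , factorsQ) (s , Q≈Ps) with factorsQ e P s mP Q≈Ps
  ... | inj₁ refl = ⊥-elim (ℕₚ.<-irrefl refl 1≤e)
  ... | inj₂ refl with IsMonic-cofactor e e Q P s mQ mP Q≈Ps
  ...   | _ , ms = ≈-sym (≈-trans Q≈Ps (≈-trans (⊗-congʳ P s≈1) (⊗-identityʳ P)))
    where
    s≈1 : s ≈ oneP 𝔽
    s≈1 = ≈⟦lowerCoeffs⟧ 0 s (subst (λ z → IsMonic z s) (ℕₚ.n∸n≡0 e) ms)

  -- Σ_{P^j ∣ f} deg P = deg f

  infixr 8 _^ᵖ_
  _^ᵖ_ : Pol → ℕ → Pol
  _^ᵖ_ = powP 𝔽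

  IsMonic-^ : ∀ {e P} → IsMonic e P → ∀ j → IsMonic (e * j) (P ^ᵖ j)
  IsMonic-^ {e} {P} mP zero    = subst (λ z → IsMonic z (oneP 𝔽)) (sym (ℕₚ.*-zeroʳ e)) (⟦⟧-monic []ᵥ)
  IsMonic-^ {e} {P} mP (suc j) = subst (λ z → IsMonic z (P ^ᵖ suc j)) (sym (ℕₚ.*-suc e j)) (IsMonic-⊗ e (e * j) P (P ^ᵖ j) mP (IsMonic-^ mP j))

  𝟙[_^_∣_] : ∀ {e} → Monic 𝔽 e → ℕ → Pol → ℕ
  𝟙[_^_∣_] {e} Q j f = [ does (∣? (e * j) (⟦ Q ⟧ ^ᵖ j) (IsMonic-^ (⟦⟧-monic Q) j) f) ]ᵇ

  𝟙[^∣]≡1 : ∀ {e} (Q : Monic 𝔽 e) j f → ⟦ Q ⟧ ^ᵖ j ∣ f → 𝟙[ Q ^ j ∣ f ] ≡ 1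
  𝟙[^∣]≡1 {e} Q j f Qʲ∣f with ∣? (e * j) (⟦ Q ⟧ ^ᵖ j) (IsMonic-^ (⟦⟧-monic Q) j) f
  ... | yes _   = refl
  ... | no  Qʲ∤f = ⊥-elim (Qʲ∤f Qʲ∣f)

  𝟙[^∣]≡0 : ∀ {e} (Q : Monic 𝔽 e) j f → ¬ ⟦ Q ⟧ ^ᵖ j ∣ f → 𝟙[ Q ^ j ∣ f ] ≡ 0
  𝟙[^∣]≡0 {e} Q j f Qʲ∤f with ∣? (e * j) (⟦ Q ⟧ ^ᵖ j) (IsMonic-^ (⟦⟧-monic Q) j) f
  ... | yes Qʲ∣f = ⊥-elim (Qʲ∤f Qʲ∣f)
  ... | no  _    = refl

  𝟙[^∣]-cong : ∀ {e} (Q : Monic 𝔽 e) j j′ f g →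
    (⟦ Q ⟧ ^ᵖ j ∣ f → ⟦ Q ⟧ ^ᵖ j′ ∣ g) → (⟦ Q ⟧ ^ᵖ j′ ∣ g → ⟦ Q ⟧ ^ᵖ j ∣ f) → 𝟙[ Q ^ j ∣ f ] ≡ 𝟙[ Q ^ j′ ∣ g ]
  𝟙[^∣]-cong {e} Q j j′ f g to from with ∣? (e * j) (⟦ Q ⟧ ^ᵖ j) (IsMonic-^ (⟦⟧-monic Q) j) f
  ... | yes Qʲ∣f = sym (𝟙[^∣]≡1 Q j′ g (to Qʲ∣f))
  ... | no  Qʲ∤f = sym (𝟙[^∣]≡0 Q j′ g (λ d → Qʲ∤f (from d)))

  𝟙[^∣]-deg : ∀ {e} (Q : Monic 𝔽 e) j m f → IsMonic m f → m < e * j → 𝟙[ Q ^ j ∣ f ] ≡ 0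
  𝟙[^∣]-deg {e} Q j m f mf m<ej = 𝟙[^∣]≡0 Q j f λ { (s , f≈Qʲs) →
    ℕₚ.<⇒≱ m<ej (proj₁ (IsMonic-cofactor m (e * j) f (⟦ Q ⟧ ^ᵖ j) s mf (IsMonic-^ (⟦⟧-monic Q) j) f≈Qʲs)) }

  1∣ : ∀ g → oneP 𝔽 ∣ g
  1∣ g = g , ≈-sym (⊗-identityˡ g)

  ^-suc-∣-⊗⇔ : ∀ e P f′ j → IsMonic e P → (P ^ᵖ suc j ∣ P ⊗ f′ → P ^ᵖ j ∣ f′) × (P ^ᵖ j ∣ f′ → P ^ᵖ suc j ∣ P ⊗ f′)
  ^-suc-∣-⊗⇔ e P f′ j mP =
    (λ { (w , eq) → w , IsMonic-⊗-cancelˡ e P f′ (P ^ᵖ j ⊗ w) mP (≈-trans eq (⊗-assoc P (P ^ᵖ j) w)) }) ,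
    (λ { (w , eq) → w , ≈-trans (⊗-congʳ P eq) (≈-sym (⊗-assoc P (P ^ᵖ j) w)) })

  ^∣-⊗-coprime : ∀ e e₀ P Q₀ → Irreducible e P → Irreducible e₀ Q₀ → ¬ P ≈ Q₀ → ∀ j g → P ^ᵖ j ∣ Q₀ ⊗ g → P ^ᵖ j ∣ g
  ^∣-⊗-coprime e e₀ P Q₀ irrP irrQ P≉Q zero    g _ = 1∣ g
  ^∣-⊗-coprime e e₀ P Q₀ irrP irrQ P≉Q (suc j) g (u , Q₀g≈) with euclid e P irrP Q₀ g (P ^ᵖ j ⊗ u , ≈-trans Q₀g≈ (⊗-assoc P (P ^ᵖ j) u))
  ... | inj₁ P∣Q₀ = ⊥-elim (P≉Q (Irreducible-∣⇒≈ e e₀ P Q₀ irrP irrQ P∣Q₀))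
  ... | inj₂ (g₁ , g≈Pg₁) with ^∣-⊗-coprime e e₀ P Q₀ irrP irrQ P≉Q j g₁ (u ,
          IsMonic-⊗-cancelˡ e P (Q₀ ⊗ g₁) (P ^ᵖ j ⊗ u) (proj₁ irrP)
            (≈-trans (≈-sym (⊗-⊗-comm P Q₀ g₁)) (≈-trans (⊗-congʳ Q₀ (≈-sym g≈Pg₁)) (≈-trans Q₀g≈ (⊗-assoc P (P ^ᵖ j) u)))))
  ...   | v , g₁≈ = v , ≈-trans g≈Pg₁ (≈-trans (⊗-congʳ P g₁≈) (≈-sym (⊗-assoc P (P ^ᵖ j) v)))

  multiplicity : ℕ → ∀ {e} → Monic 𝔽 e → Pol → ℕ
  multiplicity N Q f = Σ[ range1 N ] λ j → 𝟙[ Q ^ j ∣ f ]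

  irreducibleMultiplicity : ℕ → (e : ℕ) → Monic 𝔽 e → Pol → ℕ
  irreducibleMultiplicity N e Q f = [ isIrreducible e Q ]ᵇ * (e * multiplicity N Q f)

  divisorDegrees : ℕ → Pol → ℕ
  divisorDegrees N f = Σ[ range1 N ] λ e → Σ[ monics e ] λ Q → irreducibleMultiplicity N e Q f

  multiplicity-cong : ∀ N {e} (Q : Monic 𝔽 e) f g → f ≈ g → multiplicity N Q f ≡ multiplicity N Q g
  multiplicity-cong N Q f g f≈g = Σ-cong (range1 N) λ j → 𝟙[^∣]-cong Q j j f g (∣-resp-≈ {⟦ Q ⟧ ^ᵖ j} f≈g) (∣-resp-≈ {⟦ Q ⟧ ^ᵖ j} (≈-sym f≈g))

  multiplicity-⊗-self : ∀ N e (Q : Monic 𝔽 e) d′ f′ → 1 ≤ e → IsMonic d′ f′ → d′ < N →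
    multiplicity N Q (⟦ Q ⟧ ⊗ f′) ≡ suc (multiplicity N Q f′)
  multiplicity-⊗-self N e Q d′ f′ 1≤e mf′ d′<N = begin
    multiplicity N Q (⟦ Q ⟧ ⊗ f′)                   ≡⟨ Σ-range1 N _ ⟩
    sumTo N (λ i → 𝟙[ Q ^ suc i ∣ ⟦ Q ⟧ ⊗ f′ ])       ≡⟨ sumTo-cong N (λ i _ → 𝟙[^∣]-cong Q (suc i) i _ f′ (proj₁ (⇔ i)) (proj₂ (⇔ i))) ⟩
    sumTo N h                                      ≡⟨ ℕₚ.+-identityʳ (sumTo N h) ⟨
    sumTo N h + 0                                  ≡⟨ cong (sumTo N h +_) hN≡0 ⟨
    sumTo (suc N) h                                ≡⟨ sumTo-unfoldˡ N h ⟩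
    h 0 + sumTo N (λ i → h (suc i))                ≡⟨ cong (_+ sumTo N (λ i → h (suc i))) (𝟙[^∣]≡1 Q 0 f′ (1∣ f′)) ⟩
    suc (sumTo N (λ i → h (suc i)))                ≡⟨ cong suc (Σ-range1 N h) ⟨
    suc (multiplicity N Q f′)                      ∎
    where
    h : ℕ → ℕ
    h j = 𝟙[ Q ^ j ∣ f′ ]
    ⇔ = λ i → ^-suc-∣-⊗⇔ e ⟦ Q ⟧ f′ i (⟦⟧-monic Q)
    hN≡0 : h N ≡ 0
    hN≡0 = 𝟙[^∣]-deg Q N d′ f′ mf′ (ℕₚ.<-≤-trans d′<N (ℕₚ.≤-trans (ℕₚ.≤-reflexive (sym (ℕₚ.*-identityˡ N))) (ℕₚ.*-monoˡ-≤ N 1≤e)))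

  multiplicity-⊗-other : ∀ N e e₀ (Q : Monic 𝔽 e) (Q₀ : Monic 𝔽 e₀) g → Irreducible e ⟦ Q ⟧ → Irreducible e₀ ⟦ Q₀ ⟧ →
    ¬ ⟦ Q ⟧ ≈ ⟦ Q₀ ⟧ → multiplicity N Q (⟦ Q₀ ⟧ ⊗ g) ≡ multiplicity N Q g
  multiplicity-⊗-other N e e₀ Q Q₀ g irrQ irrQ₀ Q≉Q₀ = Σ-cong (range1 N) λ j → 𝟙[^∣]-cong Q j j (⟦ Q₀ ⟧ ⊗ g) g
    (^∣-⊗-coprime e e₀ ⟦ Q ⟧ ⟦ Q₀ ⟧ irrQ irrQ₀ Q≉Q₀ j g)
    (λ { (w , g≈) → ⟦ Q₀ ⟧ ⊗ w , ≈-trans (⊗-congʳ ⟦ Q₀ ⟧ g≈) (⊗-⊗-comm (⟦ Q ⟧ ^ᵖ j) ⟦ Q₀ ⟧ w) })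

  isFactor : Pol → (e : ℕ) → Monic 𝔽 e → ℕ
  isFactor Q₀ e Q = [ isIrreducible e Q ]ᵇ * (e * [ Q₀ == ⟦ Q ⟧ ]ᵇ)

  irreducibleMultiplicity-⊗ : ∀ N e (Q : Monic 𝔽 e) e₀ (Q₀ : Monic 𝔽 e₀) d′ f f′ → isIrreducible e₀ Q₀ ≡ true →
    f ≈ ⟦ Q₀ ⟧ ⊗ f′ → IsMonic d′ f′ → d′ < N →
    irreducibleMultiplicity N e Q f ≡ irreducibleMultiplicity N e Q f′ + isFactor ⟦ Q₀ ⟧ e Q
  irreducibleMultiplicity-⊗ N e Q e₀ Q₀ d′ f f′ irr₀ f≈ mf′ d′<N with isIrreducible e Q in irr
  ... | false = refl
  ... | true with ⟦ Q₀ ⟧ ≈? ⟦ Q ⟧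
  ...   | yes Q₀≈Q = begin
    1 * (e * multiplicity N Q f)
      ≡⟨ cong (λ z → 1 * (e * z)) (trans (multiplicity-cong N Q f (⟦ Q ⟧ ⊗ f′) (≈-trans f≈ (⊗-congˡ f′ Q₀≈Q)))
                                         (multiplicity-⊗-self N e Q d′ f′ (proj₁ (proj₂ (isIrreducible-sound e Q irr))) mf′ d′<N)) ⟩
    1 * (e * suc (multiplicity N Q f′))                          ≡⟨ distrib e (multiplicity N Q f′) ⟩
    1 * (e * multiplicity N Q f′) + 1 * (e * 1)                  ≡⟨ cong (λ z → 1 * (e * multiplicity N Q f′) + 1 * (e * z)) ([==]ᵇ≡1 ⟦ Q₀ ⟧ ⟦ Q ⟧ Q₀≈Q) ⟨
    1 * (e * multiplicity N Q f′) + 1 * (e * [ ⟦ Q₀ ⟧ == ⟦ Q ⟧ ]ᵇ) ∎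
    where
    distrib : ∀ e v → 1 * (e * suc v) ≡ 1 * (e * v) + 1 * (e * 1)
    distrib = solve-∀
  ...   | no Q₀≉Q = begin
    1 * (e * multiplicity N Q f)
      ≡⟨ cong (λ z → 1 * (e * z)) (trans (multiplicity-cong N Q f (⟦ Q₀ ⟧ ⊗ f′) f≈)
           (multiplicity-⊗-other N e e₀ Q Q₀ f′ (isIrreducible-sound e Q irr) (isIrreducible-sound e₀ Q₀ irr₀) (λ z → Q₀≉Q (≈-sym z)))) ⟩
    1 * (e * multiplicity N Q f′)                                ≡⟨ +0 e (multiplicity N Q f′) ⟩
    1 * (e * multiplicity N Q f′) + 1 * (e * 0)                  ≡⟨ cong (λ z → 1 * (e * multiplicity N Q f′) + 1 * (e * z)) ([==]ᵇ≡0 ⟦ Q₀ ⟧ ⟦ Q ⟧ Q₀≉Q) ⟨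
    1 * (e * multiplicity N Q f′) + 1 * (e * [ ⟦ Q₀ ⟧ == ⟦ Q ⟧ ]ᵇ) ∎
    where
    +0 : ∀ e v → 1 * (e * v) ≡ 1 * (e * v) + 1 * (e * 0)
    +0 = solve-∀

  Σ-isFactor : ∀ N e₀ (Q₀ : Monic 𝔽 e₀) → isIrreducible e₀ Q₀ ≡ true → 1 ≤ e₀ → e₀ ≤ N →
    Σ[ range1 N ] (λ e → Σ[ monics e ] (isFactor ⟦ Q₀ ⟧ e)) ≡ e₀
  Σ-isFactor N (suc i₀) Q₀ irr₀ _ e₀≤N = trans (Σ-range1 N F) (trans (sumTo-single N i₀ (λ i → F (suc i)) e₀≤N others) F[e₀]≡e₀)
    where
    e₀ = suc i₀
    F : ℕ → ℕ
    F e = Σ[ monics e ] (isFactor ⟦ Q₀ ⟧ e)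
    reorder : ∀ e Q → isFactor ⟦ Q₀ ⟧ e Q ≡ [ ⟦ Q₀ ⟧ == ⟦ Q ⟧ ]ᵇ * ([ isIrreducible e Q ]ᵇ * e)
    reorder e Q = swap [ isIrreducible e Q ]ᵇ e [ ⟦ Q₀ ⟧ == ⟦ Q ⟧ ]ᵇ
      where
      swap : ∀ a e b → a * (e * b) ≡ b * (a * e)
      swap = solve-∀
    others : ∀ j → j < N → ¬ j ≡ i₀ → F (suc j) ≡ 0
    others j _ j≢i₀ = trans (Σ-cong (monics (suc j)) (reorder (suc j)))
      (Σmonics-none e₀ (suc j) ⟦ Q₀ ⟧ (⟦⟧-monic Q₀) (λ eq → j≢i₀ (sym (ℕₚ.suc-injective eq))) (λ Q → [ isIrreducible (suc j) Q ]ᵇ * suc j))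
    F[e₀]≡e₀ : F e₀ ≡ e₀
    F[e₀]≡e₀ = begin
      F e₀                                                         ≡⟨ Σ-cong (monics e₀) (reorder e₀) ⟩
      Σ[ monics e₀ ] (λ Q → [ ⟦ Q₀ ⟧ == ⟦ Q ⟧ ]ᵇ * ([ isIrreducible e₀ Q ]ᵇ * e₀))
        ≡⟨ Σmonics-find e₀ ⟦ Q₀ ⟧ (⟦⟧-monic Q₀) (λ Q → [ isIrreducible e₀ Q ]ᵇ * e₀) ⟩
      [ isIrreducible e₀ (lowerCoeffs e₀ ⟦ Q₀ ⟧) ]ᵇ * e₀
        ≡⟨ cong (λ Q → [ isIrreducible e₀ Q ]ᵇ * e₀) (⟦⟧-injective Q₀ _ (≈⟦lowerCoeffs⟧ e₀ ⟦ Q₀ ⟧ (⟦⟧-monic Q₀))) ⟨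
      [ isIrreducible e₀ Q₀ ]ᵇ * e₀                                ≡⟨ cong (λ b → [ b ]ᵇ * e₀) irr₀ ⟩
      1 * e₀                                                       ≡⟨ ℕₚ.*-identityˡ e₀ ⟩
      e₀                                                           ∎

  private
    divisorDegrees-1 : ∀ N f → IsMonic 0 f → divisorDegrees N f ≡ 0
    divisorDegrees-1 N f mf = trans (Σ-cong (range1 N) (λ e → trans (Σ-cong (monics e) (term≡0 e)) (Σ-0 (monics e)))) (Σ-0 (range1 N))
      where
      term≡0 : ∀ e Q → irreducibleMultiplicity N e Q f ≡ 0
      term≡0 e Q with isIrreducible e Q in irr
      ... | false = refl
      ... | true  = trans (cong (λ z → 1 * (e * z)) multiplicity≡0) (cong (1 *_) (ℕₚ.*-zeroʳ e))
        where
        1≤e = proj₁ (proj₂ (isIrreducible-sound e Q irr))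
        multiplicity≡0 : multiplicity N Q f ≡ 0
        multiplicity≡0 = trans (Σ-range1 N _) (sumTo-0 N (λ i _ → 𝟙[^∣]-deg Q (suc i) 0 f mf (ℕₚ.<-≤-trans (s≤s z≤n) (ℕₚ.*-mono-≤ 1≤e (s≤s z≤n)))))

  -- the first argument bounds the degree and drives the recursion
  divisorDegrees≡deg : ∀ fuel N d f → d < fuel → d ≤ N → IsMonic d f → divisorDegrees N f ≡ d
  divisorDegrees≡deg (suc fuel) N zero     f _         _   mf = divisorDegrees-1 N f mf
  divisorDegrees≡deg (suc fuel) N (suc d′) f (s≤s d′<fuel) d≤N mf
    with irreducibleFactor (suc (suc d′)) (suc d′) (lowerCoeffs (suc d′) f) ℕₚ.≤-refl (s≤s z≤n)
  ... | e₀ , Q₀ , irr₀ , f′ , f≈Q₀f′ = begin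
    divisorDegrees N f
      ≡⟨ Σ-cong (range1 N) (λ e → trans (Σ-cong (monics e) (λ Q → irreducibleMultiplicity-⊗ N e Q e₀ Q₀ d″ f f′ irr₀ f≈ mf′ d″<N)) (Σ-+ (monics e) _ _)) ⟩
    Σ[ range1 N ] (λ e → Σ[ monics e ] (λ Q → irreducibleMultiplicity N e Q f′) + Σ[ monics e ] (isFactor ⟦ Q₀ ⟧ e))
      ≡⟨ Σ-+ (range1 N) _ _ ⟩
    divisorDegrees N f′ + Σ[ range1 N ] (λ e → Σ[ monics e ] (isFactor ⟦ Q₀ ⟧ e))
      ≡⟨ cong₂ _+_ (divisorDegrees≡deg fuel N d″ f′ d″<fuel (ℕₚ.<⇒≤ d″<N) mf′) (Σ-isFactor N e₀ Q₀ irr₀ 1≤e₀ (ℕₚ.≤-trans e₀≤d d≤N)) ⟩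
    d″ + e₀                ≡⟨ ℕₚ.m∸n+n≡m e₀≤d ⟩
    suc d′                 ∎
    where
    f≈ : f ≈ ⟦ Q₀ ⟧ ⊗ f′
    f≈ = ≈-trans (≈⟦lowerCoeffs⟧ _ f mf) f≈Q₀f′
    1≤e₀ : 1 ≤ e₀
    1≤e₀ = proj₁ (proj₂ (isIrreducible-sound e₀ Q₀ irr₀))
    cofactor = IsMonic-cofactor (suc d′) e₀ f ⟦ Q₀ ⟧ f′ mf (⟦⟧-monic Q₀) f≈
    e₀≤d : e₀ ≤ suc d′
    e₀≤d = proj₁ cofactor
    d″ = suc d′ ∸ e₀
    mf′ : IsMonic d″ f′
    mf′ = proj₂ cofactor
    d″<d : d″ < suc d′
    d″<d = ℕₚ.∸-monoʳ-< 1≤e₀ e₀≤d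
    d″<N : d″ < N
    d″<N = ℕₚ.<-≤-trans d″<d d≤N
    d″<fuel : d″ < fuel
    d″<fuel = ℕₚ.<-≤-trans d″<d d′<fuel

  -- The prime polynomial theorem

  open DivisorCounting q

  irreducibleWeight : ℕ → ℕ
  irreducibleWeight e = Σ[ monics e ] (λ Q → [ isIrreducible e Q ]ᵇ) * e

  Σmonics-𝟙[^∣] : ∀ n e (Q : Monic 𝔽 e) j → Σ[ monics n ] (λ f → 𝟙[ Q ^ j ∣ ⟦ f ⟧ ]) ≡ multiples n (e * j)
  Σmonics-𝟙[^∣] n e Q j with ℕₚ.≤-<-connex (e * j) n
  ... | inj₂ n<ej = trans (Σ-cong (monics n) (λ f → 𝟙[^∣]-deg Q j n ⟦ f ⟧ (⟦⟧-monic f) n<ej))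
                          (trans (Σ-0 (monics n)) (sym (multiples-> n (e * j) n<ej)))
  ... | inj₁ ej≤n = begin
    Σ[ monics n ] (λ f → 𝟙[ Q ^ j ∣ ⟦ f ⟧ ])                          ≡⟨ Σ-cong (monics n) as-cofactor-count ⟩
    Σ[ monics n ] (λ f → Σ[ monics k ] (λ h → [ R ⊗ ⟦ h ⟧ == ⟦ f ⟧ ]ᵇ)) ≡⟨ Σ-comm (monics n) (monics k) _ ⟩
    Σ[ monics k ] (λ h → Σ[ monics n ] (λ f → [ R ⊗ ⟦ h ⟧ == ⟦ f ⟧ ]ᵇ)) ≡⟨ Σ-cong (monics k) unique-product ⟩
    Σ[ monics k ] (λ h → 1)                                         ≡⟨ Σmonics-const k 1 ⟩
    1 * q ^ k                                                       ≡⟨ ℕₚ.*-identityˡ _ ⟩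
    q ^ (n ∸ e * j)                                                 ≡⟨ multiples-≤ n (e * j) ej≤n ⟨
    multiples n (e * j)                                             ∎
    where
    R = ⟦ Q ⟧ ^ᵖ j
    k = n ∸ e * j
    mR : IsMonic (e * j) R
    mR = IsMonic-^ (⟦⟧-monic Q) j
    mRh : ∀ h → IsMonic n (R ⊗ ⟦ h ⟧)
    mRh h = subst (λ z → IsMonic z (R ⊗ ⟦ h ⟧)) (ℕₚ.m+[n∸m]≡n ej≤n) (IsMonic-⊗ (e * j) k R ⟦ h ⟧ mR (⟦⟧-monic h))
    unique-product : ∀ h → Σ[ monics n ] (λ f → [ R ⊗ ⟦ h ⟧ == ⟦ f ⟧ ]ᵇ) ≡ 1
    unique-product h = trans (Σ-cong (monics n) (λ f → sym (ℕₚ.*-identityʳ _))) (Σmonics-find n (R ⊗ ⟦ h ⟧) (mRh h) (λ _ → 1))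
    as-cofactor-count : ∀ f → 𝟙[ Q ^ j ∣ ⟦ f ⟧ ] ≡ Σ[ monics k ] (λ h → [ R ⊗ ⟦ h ⟧ == ⟦ f ⟧ ]ᵇ)
    as-cofactor-count f with ∣? (e * j) R mR ⟦ f ⟧
    ... | no R∤f = sym (trans (Σ-cong (monics k) (λ h → [==]ᵇ≡0 (R ⊗ ⟦ h ⟧) ⟦ f ⟧ (λ eq → R∤f (⟦ h ⟧ , ≈-sym eq)))) (Σ-0 (monics k)))
    ... | yes (s , f≈Rs) = sym (trans (Σmonics-single k w _ others) ([==]ᵇ≡1 (R ⊗ ⟦ w ⟧) ⟦ f ⟧ (≈-sym (≈-trans f≈Rs (⊗-congʳ R s≈w)))))
      where
      ms : IsMonic k s
      ms = proj₂ (IsMonic-cofactor n (e * j) ⟦ f ⟧ R s (⟦⟧-monic f) mR f≈Rs)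
      w = lowerCoeffs k s
      s≈w : s ≈ ⟦ w ⟧
      s≈w = ≈⟦lowerCoeffs⟧ k s ms
      others : ∀ h → ¬ h ≡ w → [ R ⊗ ⟦ h ⟧ == ⟦ f ⟧ ]ᵇ ≡ 0
      others h h≢w = [==]ᵇ≡0 (R ⊗ ⟦ h ⟧) ⟦ f ⟧ (λ eq → h≢w (⟦⟧-injective h w
        (≈-trans (IsMonic-⊗-cancelˡ (e * j) R ⟦ h ⟧ s mR (≈-trans eq f≈Rs)) s≈w)))

  divisorWeight-irreducibles : ∀ n → divisorWeight irreducibleWeight n ≡ n * q ^ n
  divisorWeight-irreducibles n = sym (begin
    n * q ^ n                                                                ≡⟨ Σmonics-const n n ⟨
    Σ[ monics n ] (λ f → n)
      ≡⟨ Σ-cong (monics n) (λ f → sym (divisorDegrees≡deg (suc n) n n ⟦ f ⟧ ℕₚ.≤-refl ℕₚ.≤-refl (⟦⟧-monic f))) ⟩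
    Σ[ monics n ] (λ f → divisorDegrees n ⟦ f ⟧)                             ≡⟨ Σ-comm (monics n) (range1 n) _ ⟩
    Σ[ range1 n ] (λ e → Σ[ monics n ] (λ f → Σ[ monics e ] (λ Q → W e Q f))) ≡⟨ Σ-cong (range1 n) (λ e → Σ-comm (monics n) (monics e) _) ⟩
    Σ[ range1 n ] (λ e → Σ[ monics e ] (λ Q → Σ[ monics n ] (W e Q)))          ≡⟨ Σ-cong (range1 n) (λ e → Σ-cong (monics e) (Σmonics-W e)) ⟩
    Σ[ range1 n ] (λ e → Σ[ monics e ] (λ Q → [ isIrreducible e Q ]ᵇ * (e * m e)))
      ≡⟨ Σ-cong (range1 n) (λ e → Σ-*ʳ (monics e) _ (λ Q → [ isIrreducible e Q ]ᵇ)) ⟩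
    Σ[ range1 n ] (λ e → Σ[ monics e ] (λ Q → [ isIrreducible e Q ]ᵇ) * (e * m e))
      ≡⟨ Σ-cong (range1 n) (λ e → sym (ℕₚ.*-assoc (Σ[ monics e ] (λ Q → [ isIrreducible e Q ]ᵇ)) e (m e))) ⟩
    divisorWeight irreducibleWeight n                                       ∎)
    where
    m : ℕ → ℕ
    m e = Σ[ range1 n ] (λ j → multiples n (e * j))
    W : (e : ℕ) → Monic 𝔽 e → Monic 𝔽 n → ℕ
    W e Q f = irreducibleMultiplicity n e Q ⟦ f ⟧
    Σmonics-W : ∀ e Q → Σ[ monics n ] (W e Q) ≡ [ isIrreducible e Q ]ᵇ * (e * m e)
    Σmonics-W e Q = begin
      Σ[ monics n ] (λ f → [ isIrreducible e Q ]ᵇ * (e * multiplicity n Q ⟦ f ⟧))  ≡⟨ Σ-*ˡ (monics n) [ isIrreducible e Q ]ᵇ (λ f → e * multiplicity n Q ⟦ f ⟧) ⟩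
      [ isIrreducible e Q ]ᵇ * Σ[ monics n ] (λ f → e * multiplicity n Q ⟦ f ⟧)    ≡⟨ cong ([ isIrreducible e Q ]ᵇ *_) (Σ-*ˡ (monics n) e _) ⟩
      [ isIrreducible e Q ]ᵇ * (e * Σ[ monics n ] (λ f → multiplicity n Q ⟦ f ⟧))
        ≡⟨ cong (λ z → [ isIrreducible e Q ]ᵇ * (e * z)) (trans (Σ-comm (monics n) (range1 n) (λ f j → 𝟙[ Q ^ j ∣ ⟦ f ⟧ ])) (Σ-cong (range1 n) (Σmonics-𝟙[^∣] n e Q))) ⟩
      [ isIrreducible e Q ]ᵇ * (e * m e)                                         ∎

  ΣΛ : ℕ → ℕ
  ΣΛ m = Σ[ monics m ] (Λ 𝔽 m)

  ΣΛ≡powerWeight : ∀ m → ΣΛ m ≡ powerWeight irreducibleWeight m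
  ΣΛ≡powerWeight m = begin
    Σ[ monics m ] (Λ 𝔽 m)
      ≡⟨ Σ-comm (monics m) (range1 m) _ ⟩
    Σ[ range1 m ] (λ e → Σ[ monics m ] (λ f → Σ[ monics e ] λ P → Σ[ range1 m ] λ j → T e P j f))
      ≡⟨ Σ-cong (range1 m) (λ e → trans (Σ-comm (monics m) (monics e) _) (Σ-cong (monics e) (λ P → Σ-comm (monics m) (range1 m) _))) ⟩
    Σ[ range1 m ] (λ e → Σ[ monics e ] λ P → Σ[ range1 m ] λ j → Σ[ monics m ] (T e P j))
      ≡⟨ Σ-cong (range1 m) (λ e → Σ-cong (monics e) (λ P → Σ-cong (range1 m) (Σmonics-T e P))) ⟩
    Σ[ range1 m ] (λ e → Σ[ monics e ] λ P → Σ[ range1 m ] λ j → ([ isIrreducible e P ]ᵇ * e) * [ e * j ≡ᵇ m ]ᵇ)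
      ≡⟨ Σ-cong (range1 m) (λ e → factor-out e) ⟩
    powerWeight irreducibleWeight m ∎
    where
    T : (e : ℕ) → Monic 𝔽 e → ℕ → Monic 𝔽 m → ℕ
    T e P j f = [ isIrreducible e P ∧ (⟦ P ⟧ ^ᵖ j == ⟦ f ⟧) ]ᵇ * e
    exact : ℕ → ℕ
    exact e = Σ[ range1 m ] (λ j → [ e * j ≡ᵇ m ]ᵇ)
    factor-out : ∀ e → Σ[ monics e ] (λ P → Σ[ range1 m ] λ j → ([ isIrreducible e P ]ᵇ * e) * [ e * j ≡ᵇ m ]ᵇ)
                       ≡ irreducibleWeight e * exact e
    factor-out e = trans (Σ-cong (monics e) (λ P → Σ-*ˡ (range1 m) ([ isIrreducible e P ]ᵇ * e) _))
                   (trans (Σ-*ʳ (monics e) (exact e) (λ P → [ isIrreducible e P ]ᵇ * e))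
                          (cong (_* exact e) (Σ-*ʳ (monics e) e (λ P → [ isIrreducible e P ]ᵇ))))
    Σmonics-T : ∀ e P j → Σ[ monics m ] (T e P j) ≡ ([ isIrreducible e P ]ᵇ * e) * [ e * j ≡ᵇ m ]ᵇ
    Σmonics-T e P j = trans (Σ-cong (monics m) (λ f → trans (cong (_* e) ([∧]ᵇ (isIrreducible e P) (⟦ P ⟧ ^ᵖ j == ⟦ f ⟧)))
                                                     (reorder [ isIrreducible e P ]ᵇ [ ⟦ P ⟧ ^ᵖ j == ⟦ f ⟧ ]ᵇ e))) evaluate
      where
      reorder : ∀ a b e → a * b * e ≡ b * (a * e)
      reorder = solve-∀
      evaluate : Σ[ monics m ] (λ f → [ ⟦ P ⟧ ^ᵖ j == ⟦ f ⟧ ]ᵇ * ([ isIrreducible e P ]ᵇ * e)) ≡ ([ isIrreducible e P ]ᵇ * e) * [ e * j ≡ᵇ m ]ᵇ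
      evaluate with e * j ℕₚ.≟ m
      ... | yes refl = trans (Σmonics-find (e * j) (⟦ P ⟧ ^ᵖ j) (IsMonic-^ (⟦⟧-monic P) j) _)
                             (trans (sym (ℕₚ.*-identityʳ _)) (cong (λ b → ([ isIrreducible e P ]ᵇ * e) * [ b ]ᵇ) (sym (dec-true (e * j ℕₚ.≟ e * j) refl))))
      ... | no ej≢m  = trans (Σmonics-none (e * j) m (⟦ P ⟧ ^ᵖ j) (IsMonic-^ (⟦⟧-monic P) j) ej≢m _)
                             (sym (trans (cong (λ b → ([ isIrreducible e P ]ᵇ * e) * [ b ]ᵇ) (dec-false (e * j ℕₚ.≟ m) ej≢m)) (ℕₚ.*-zeroʳ ([ isIrreducible e P ]ᵇ * e))))

  prime-polynomial-theorem : ∀ m → 1 ≤ m → ΣΛ m ≡ q ^ m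
  prime-polynomial-theorem m 1≤m = trans (ΣΛ≡powerWeight m) (powerWeight≡q^ irreducibleWeight divisorWeight-irreducibles m 1≤m)

  -- Σ_{f ∈ 𝓜_d} Λ_k(f) = C(d−1, k−1) q^d

  ΣΛ[_] : ℕ → ℕ → ℕ
  ΣΛ[ k ] d = Σ[ monics d ] (Λ[_] 𝔽 k d)

  IsMonic-⟦⟧⊗⟦⟧ : ∀ {e d} → e ≤ d → (g : Monic 𝔽 e) (r : Monic 𝔽 (d ∸ e)) → IsMonic d (⟦ g ⟧ ⊗ ⟦ r ⟧)
  IsMonic-⟦⟧⊗⟦⟧ {e} {d} e≤d g r =
    subst (λ z → IsMonic z (⟦ g ⟧ ⊗ ⟦ r ⟧)) (ℕₚ.m+[n∸m]≡n e≤d) (IsMonic-⊗ e (d ∸ e) ⟦ g ⟧ ⟦ r ⟧ (⟦⟧-monic g) (⟦⟧-monic r))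

  ΣΛ[suc] : ∀ k d → ΣΛ[ suc k ] d ≡ Σ[ range0 d ] (λ e → ΣΛ e * ΣΛ[ k ] (d ∸ e))
  ΣΛ[suc] k d = begin
    Σ[ monics d ] (λ f → Σ[ range0 d ] (λ e → Σ[ monics e ] λ g → Σ[ monics (d ∸ e) ] λ r → T e g r f))
      ≡⟨ Σ-comm (monics d) (range0 d) _ ⟩
    Σ[ range0 d ] (λ e → Σ[ monics d ] (λ f → Σ[ monics e ] λ g → Σ[ monics (d ∸ e) ] λ r → T e g r f))
      ≡⟨ trans (Σ-range0 d _) (trans (sumTo-cong (suc d) (λ e e<1+d → degree-e e (ℕₚ.≤-pred e<1+d))) (sym (Σ-range0 d _))) ⟩
    Σ[ range0 d ] (λ e → ΣΛ e * ΣΛ[ k ] (d ∸ e)) ∎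
    where
    T : (e : ℕ) → Monic 𝔽 e → Monic 𝔽 (d ∸ e) → Monic 𝔽 d → ℕ
    T e g r f = [ ⟦ g ⟧ ⊗ ⟦ r ⟧ == ⟦ f ⟧ ]ᵇ * (Λ 𝔽 e g * Λ[_] 𝔽 k (d ∸ e) r)
    degree-e : ∀ e → e ≤ d → Σ[ monics d ] (λ f → Σ[ monics e ] λ g → Σ[ monics (d ∸ e) ] λ r → T e g r f) ≡ ΣΛ e * ΣΛ[ k ] (d ∸ e)
    degree-e e e≤d = begin
      Σ[ monics d ] (λ f → Σ[ monics e ] λ g → Σ[ monics (d ∸ e) ] λ r → T e g r f)  ≡⟨ Σ-comm (monics d) (monics e) _ ⟩
      Σ[ monics e ] (λ g → Σ[ monics d ] λ f → Σ[ monics (d ∸ e) ] λ r → T e g r f)  ≡⟨ Σ-cong (monics e) (λ g → Σ-comm (monics d) (monics (d ∸ e)) _) ⟩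
      Σ[ monics e ] (λ g → Σ[ monics (d ∸ e) ] λ r → Σ[ monics d ] λ f → T e g r f)
        ≡⟨ Σ-cong (monics e) (λ g → Σ-cong (monics (d ∸ e)) (λ r →
             Σmonics-find d (⟦ g ⟧ ⊗ ⟦ r ⟧) (IsMonic-⟦⟧⊗⟦⟧ e≤d g r) (λ _ → Λ 𝔽 e g * Λ[_] 𝔽 k (d ∸ e) r))) ⟩
      Σ[ monics e ] (λ g → Σ[ monics (d ∸ e) ] λ r → Λ 𝔽 e g * Λ[_] 𝔽 k (d ∸ e) r)  ≡⟨ Σ-cong (monics e) (λ g → Σ-*ˡ (monics (d ∸ e)) (Λ 𝔽 e g) _) ⟩
      Σ[ monics e ] (λ g → Λ 𝔽 e g * ΣΛ[ k ] (d ∸ e))                               ≡⟨ Σ-*ʳ (monics e) (ΣΛ[ k ] (d ∸ e)) (Λ 𝔽 e) ⟩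
      ΣΛ e * ΣΛ[ k ] (d ∸ e)                                                       ∎

  ⟦⟧≉1 : ∀ d (f : Monic 𝔽 (suc d)) → ¬ ⟦ f ⟧ ≈ oneP 𝔽
  ⟦⟧≉1 d f f≈1 with IsMonic-unique (suc d) 0 (oneP 𝔽) (IsMonic-resp-≈ f≈1 (⟦⟧-monic f)) (⟦⟧-monic []ᵥ)
  ... | ()

  ΣΛ[0]-0 : ΣΛ[ 0 ] 0 ≡ 1
  ΣΛ[0]-0 = cong (_+ 0) ([==]ᵇ≡1 ⟦ []ᵥ ⟧ (oneP 𝔽) ≈-refl)

  ΣΛ[0]-suc : ∀ d → ΣΛ[ 0 ] (suc d) ≡ 0
  ΣΛ[0]-suc d = trans (Σ-cong (monics (suc d)) (λ f → [==]ᵇ≡0 ⟦ f ⟧ (oneP 𝔽) (⟦⟧≉1 d f))) (Σ-0 (monics (suc d)))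

  -- C(d − 1, k), read as 0 when d = 0
  C[d-1,_] : ℕ → ℕ → ℕ
  C[d-1, k ] zero    = 0
  C[d-1, k ] (suc m) = m C k

  hockey-stick : ∀ k m → sumTo (suc m) C[d-1, k ] ≡ m C suc k
  hockey-stick k zero    = sym (k>n⇒nCk≡0 {0} {suc k} (s≤s z≤n))
  hockey-stick k (suc m) = trans (cong (_+ m C k) (hockey-stick k m)) (trans (ℕₚ.+-comm (m C suc k) (m C k)) (nCk+nC[k+1]≡[n+1]C[k+1] m k))

  ΣΛ≡C[d-1,0] : ∀ d → ΣΛ d ≡ C[d-1, 0 ] d * q ^ d
  ΣΛ≡C[d-1,0] zero    = refl
  ΣΛ≡C[d-1,0] (suc m) = trans (prime-polynomial-theorem (suc m) (s≤s z≤n)) (sym (ℕₚ.*-identityˡ _))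

  ΣΛ[suc]≡C : ∀ k d → ΣΛ[ suc k ] d ≡ C[d-1, k ] d * q ^ d
  ΣΛ[suc]≡C zero d = begin
    ΣΛ[ 1 ] d                                          ≡⟨ trans (ΣΛ[suc] 0 d) (Σ-range0 d _) ⟩
    sumTo (suc d) (λ e → ΣΛ e * ΣΛ[ 0 ] (d ∸ e))       ≡⟨ sumTo-single (suc d) d _ ℕₚ.≤-refl others ⟩
    ΣΛ d * ΣΛ[ 0 ] (d ∸ d)                             ≡⟨ cong (λ x → ΣΛ d * ΣΛ[ 0 ] x) (ℕₚ.n∸n≡0 d) ⟩
    ΣΛ d * ΣΛ[ 0 ] 0                                   ≡⟨ cong (ΣΛ d *_) ΣΛ[0]-0 ⟩
    ΣΛ d * 1                                           ≡⟨ ℕₚ.*-identityʳ _ ⟩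
    ΣΛ d                                               ≡⟨ ΣΛ≡C[d-1,0] d ⟩
    C[d-1, 0 ] d * q ^ d                               ∎
    where
    others : ∀ j → j < suc d → ¬ j ≡ d → ΣΛ j * ΣΛ[ 0 ] (d ∸ j) ≡ 0
    others j j<1+d j≢d with d ∸ j in eq
    ... | zero  = ⊥-elim (j≢d (ℕₚ.≤-antisym (ℕₚ.≤-pred j<1+d) (ℕₚ.m∸n≡0⇒m≤n eq)))
    ... | suc x = trans (cong (ΣΛ j *_) (ΣΛ[0]-suc x)) (ℕₚ.*-zeroʳ (ΣΛ j))
  ΣΛ[suc]≡C (suc k) zero    = ΣΛ[suc] (suc k) 0
  ΣΛ[suc]≡C (suc k) (suc m) = begin
    ΣΛ[ suc (suc k) ] (suc m)                                   ≡⟨ trans (ΣΛ[suc] (suc k) (suc m)) (Σ-range0 (suc m) _) ⟩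
    sumTo (suc (suc m)) (λ e → ΣΛ e * ΣΛ[ suc k ] (suc m ∸ e))   ≡⟨ sumTo-unfoldˡ (suc m) _ ⟩
    0 + sumTo (suc m) (λ i → ΣΛ (suc i) * ΣΛ[ suc k ] (m ∸ i))  ≡⟨ sumTo-cong (suc m) (λ i i<1+m → term i (ℕₚ.≤-pred i<1+m)) ⟩
    sumTo (suc m) (λ i → C[d-1, k ] (m ∸ i) * q ^ suc m)        ≡⟨ sumTo-*ʳ (suc m) (q ^ suc m) _ ⟩
    sumTo (suc m) (λ i → C[d-1, k ] (m ∸ i)) * q ^ suc m        ≡⟨ cong (_* q ^ suc m) (trans (sumTo-reverse m C[d-1, k ]) (hockey-stick k m)) ⟩
    C[d-1, suc k ] (suc m) * q ^ suc m                          ∎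
    where
    term : ∀ i → i ≤ m → ΣΛ (suc i) * ΣΛ[ suc k ] (m ∸ i) ≡ C[d-1, k ] (m ∸ i) * q ^ suc m
    term i i≤m = begin
      ΣΛ (suc i) * ΣΛ[ suc k ] (m ∸ i)                    ≡⟨ cong₂ _*_ (prime-polynomial-theorem (suc i) (s≤s z≤n)) (ΣΛ[suc]≡C k (m ∸ i)) ⟩
      q ^ suc i * (C[d-1, k ] (m ∸ i) * q ^ (m ∸ i))      ≡⟨ swap (q ^ suc i) (C[d-1, k ] (m ∸ i)) (q ^ (m ∸ i)) ⟩
      C[d-1, k ] (m ∸ i) * (q ^ suc i * q ^ (m ∸ i))      ≡⟨ cong (C[d-1, k ] (m ∸ i) *_) (ℕₚ.^-distribˡ-+-* q (suc i) (m ∸ i)) ⟨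
      C[d-1, k ] (m ∸ i) * q ^ (suc i + (m ∸ i))          ≡⟨ cong (λ z → C[d-1, k ] (m ∸ i) * q ^ suc z) (ℕₚ.m+[n∸m]≡n i≤m) ⟩
      C[d-1, k ] (m ∸ i) * q ^ suc m                      ∎
      where
      swap : ∀ a b c → a * (b * c) ≡ b * (a * c)
      swap = solve-∀

-- the constant K of the error term, from the recursion in ErrorTerm.ΣΛ₀[suc]-≤
errorConstant : ℕ → ℕ → ℕ
errorConstant zero    N = 0
errorConstant (suc k) N = suc N * (N * N * N * suc N ^ k) + suc N * errorConstant k N

module ErrorTerm (𝔽 : FiniteField) where

  open FiniteField 𝔽 using (q; 0F; 1F)
  open OverFiniteField 𝔽
  open CommutativeRing ring using (zeroˡ; +-identityʳ)

  q^e*q^[d∸e] : ∀ e d → e ≤ d → q ^ e * q ^ (d ∸ e) ≡ q ^ d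
  q^e*q^[d∸e] e d e≤d = trans (sym (ℕₚ.^-distribˡ-+-* q e (d ∸ e))) (cong (q ^_) (ℕₚ.m+[n∸m]≡n e≤d))

  ΣΛ≤q^ : ∀ e → ΣΛ e ≤ 1 * q ^ e
  ΣΛ≤q^ zero    = z≤n
  ΣΛ≤q^ (suc e) = ℕₚ.≤-reflexive (trans (prime-polynomial-theorem (suc e) (s≤s z≤n)) (sym (ℕₚ.*-identityˡ _)))

  convolution-≤ : ∀ d (X Y : ℕ → ℕ) α β → (∀ e → e ≤ d → X e ≤ α * q ^ e) → (∀ m → m ≤ d → Y m ≤ β * q ^ m) →
    Σ[ range0 d ] (λ e → X e * Y (d ∸ e)) ≤ suc d * (α * β) * q ^ d
  convolution-≤ d X Y α β X≤ Y≤ = begin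
    Σ[ range0 d ] (λ e → X e * Y (d ∸ e))       ≡⟨ Σ-range0 d _ ⟩
    sumTo (suc d) (λ e → X e * Y (d ∸ e))       ≤⟨ sumTo-mono-≤ (suc d) (λ e e<1+d → term e (ℕₚ.≤-pred e<1+d)) ⟩
    sumTo (suc d) (λ _ → (α * β) * q ^ d)       ≡⟨ sumTo-const (suc d) ((α * β) * q ^ d) ⟩
    suc d * ((α * β) * q ^ d)                   ≡⟨ ℕₚ.*-assoc (suc d) (α * β) (q ^ d) ⟨
    suc d * (α * β) * q ^ d                     ∎
    where
    open ℕₚ.≤-Reasoning
    reorder : ∀ a b x y → a * x * (b * y) ≡ a * b * (x * y)
    reorder = solve-∀
    term : ∀ e → e ≤ d → X e * Y (d ∸ e) ≤ (α * β) * q ^ d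
    term e e≤d = ℕₚ.≤-trans (ℕₚ.*-mono-≤ (X≤ e e≤d) (Y≤ (d ∸ e) (ℕₚ.m∸n≤m d e)))
                   (ℕₚ.≤-reflexive (trans (reorder α β (q ^ e) (q ^ (d ∸ e))) (cong ((α * β) *_) (q^e*q^[d∸e] e d e≤d))))

  ΣΛ[]≤ : ∀ k N d → d ≤ N → ΣΛ[ k ] d ≤ suc N ^ k * q ^ d
  ΣΛ[]≤ zero    N zero    _   = ℕₚ.≤-reflexive ΣΛ[0]-0
  ΣΛ[]≤ zero    N (suc d) _   = ℕₚ.≤-trans (ℕₚ.≤-reflexive (ΣΛ[0]-suc d)) z≤n
  ΣΛ[]≤ (suc k) N d     d≤N = ℕₚ.≤-trans (ℕₚ.≤-reflexive (ΣΛ[suc] k d))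
    (ℕₚ.≤-trans (convolution-≤ d ΣΛ ΣΛ[ k ] 1 (suc N ^ k) (λ e _ → ΣΛ≤q^ e) (λ m m≤d → ΣΛ[]≤ k N m (ℕₚ.≤-trans m≤d d≤N)))
                (ℕₚ.*-monoˡ-≤ (q ^ d) (ℕₚ.*-mono-≤ (s≤s d≤N) (ℕₚ.≤-reflexive (ℕₚ.*-identityˡ (suc N ^ k))))))

  vanishesAt0 : ∀ {d} → Monic 𝔽 d → Bool
  vanishesAt0 f = isZero (eval0 𝔽 ⟦ f ⟧)

  eval0≡coeff0 : ∀ p → eval0 𝔽 p ≡ coeff p 0
  eval0≡coeff0 []      = refl
  eval0≡coeff0 (x ∷ _) = refl

  coeff0-⊗ : ∀ p r → coeff (p ⊗ r) 0 ≡ coeff p 0 *ᶠ coeff r 0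
  coeff0-⊗ []       r = sym (zeroˡ _)
  coeff0-⊗ (x ∷ xs) r = trans (coeff-∷-⊗ x xs r 0) (+-identityʳ _)

  [isZero]≡1 : ∀ x → x ≡ 0F → [ isZero x ]ᵇ ≡ 1
  [isZero]≡1 x x≡0 = cong [_]ᵇ (isZero-true x x≡0)

  [isZero]≡0 : ∀ x → ¬ x ≡ 0F → [ isZero x ]ᵇ ≡ 0
  [isZero]≡0 x x≢0 = cong [_]ᵇ (isZero-false x x≢0)

  [isZero-*]≤ : ∀ a b → [ isZero (a *ᶠ b) ]ᵇ ≤ [ isZero a ]ᵇ + [ isZero b ]ᵇ
  [isZero-*]≤ a b with (a *ᶠ b) ≟ᶠ 0F
  ... | no _     = z≤n
  ... | yes ab≡0 with *ᶠ≡0⇒ a b ab≡0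
  ...   | inj₁ a≡0 = ℕₚ.≤-trans (ℕₚ.≤-reflexive (sym ([isZero]≡1 a a≡0))) (ℕₚ.m≤m+n _ _)
  ...   | inj₂ b≡0 = ℕₚ.≤-trans (ℕₚ.≤-reflexive (sym ([isZero]≡1 b b≡0))) (ℕₚ.m≤n+m _ _)

  coeff0-^≡0⇒ : ∀ P i → coeff (P ^ᵖ suc i) 0 ≡ 0F → coeff P 0 ≡ 0F
  coeff0-^≡0⇒ P i Pⁱ⁺¹₀≡0 with *ᶠ≡0⇒ (coeff P 0) (coeff (P ^ᵖ i) 0) (trans (sym (coeff0-⊗ P (P ^ᵖ i))) Pⁱ⁺¹₀≡0)
  ... | inj₁ P₀≡0 = P₀≡0
  ... | inj₂ Pⁱ₀≡0 with i
  ...   | zero   = ⊥-elim (1≢0 Pⁱ₀≡0)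
  ...   | suc i′ = coeff0-^≡0⇒ P i′ Pⁱ₀≡0

  [isZero-coeff0-^]≤ : ∀ P i → [ isZero (coeff (P ^ᵖ suc i) 0) ]ᵇ ≤ [ isZero (coeff P 0) ]ᵇ
  [isZero-coeff0-^]≤ P i with coeff (P ^ᵖ suc i) 0 ≟ᶠ 0F
  ... | no _  = z≤n
  ... | yes e = ℕₚ.≤-reflexive (sym ([isZero]≡1 _ (coeff0-^≡0⇒ P i e)))

  vanishesAt0-coeff0 : ∀ {d} (f : Monic 𝔽 d) → vanishesAt0 f ≡ isZero (coeff ⟦ f ⟧ 0)
  vanishesAt0-coeff0 f = cong isZero (eval0≡coeff0 ⟦ f ⟧)

  vanishesAt0-lowerCoeffs : ∀ d p → IsMonic d p → vanishesAt0 (lowerCoeffs d p) ≡ isZero (coeff p 0)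
  vanishesAt0-lowerCoeffs d p mp = trans (vanishesAt0-coeff0 (lowerCoeffs d p)) (cong isZero (sym (≈⟦lowerCoeffs⟧ d p mp .at 0)))

  Σmonics-[coeff0≡0] : ∀ e′ → Σ[ monics (suc e′) ] (λ P → [ isZero (coeff ⟦ P ⟧ 0) ]ᵇ) ≡ q ^ e′
  Σmonics-[coeff0≡0] e′ = begin
    Σ[ monics (suc e′) ] (λ P → [ isZero (coeff ⟦ P ⟧ 0) ]ᵇ)      ≡⟨ Σmonics-suc e′ _ ⟩
    Σ[ allFin q ] (λ x → Σ[ monics e′ ] (λ v → [ isZero x ]ᵇ))     ≡⟨ Σ-cong (allFin q) (λ x → Σmonics-const e′ [ isZero x ]ᵇ) ⟩
    Σ[ allFin q ] (λ x → [ isZero x ]ᵇ * q ^ e′)                 ≡⟨ Σ-allFin-single q _ 0F (λ x x≢0 → cong (_* q ^ e′) ([isZero]≡0 x x≢0)) ⟩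
    [ isZero 0F ]ᵇ * q ^ e′                                      ≡⟨ cong (_* q ^ e′) ([isZero]≡1 0F refl) ⟩
    1 * q ^ e′                                                   ≡⟨ ℕₚ.*-identityˡ _ ⟩
    q ^ e′                                                       ∎
    where open ≡-Reasoning

  ΣΛ₀ : ℕ → ℕ
  ΣΛ₀ e = Σ[ monics e ] (λ g → [ vanishesAt0 g ]ᵇ * Λ 𝔽 e g)

  ΣΛ₀[_] : ℕ → ℕ → ℕ
  ΣΛ₀[ k ] d = Σ[ monics d ] (λ f → [ vanishesAt0 f ]ᵇ * Λ[_] 𝔽 k d f)

  private
    -- P^(j+1) can vanish at 0 only if P does
    primePowerTerm₀-≤ : ∀ e e′ (P : Monic 𝔽 e′) j →
      Σ[ monics e ] (λ g → [ vanishesAt0 g ]ᵇ * ([ isIrreducible e′ P ∧ (⟦ P ⟧ ^ᵖ suc j == ⟦ g ⟧) ]ᵇ * e′))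
        ≤ [ isZero (coeff ⟦ P ⟧ 0) ]ᵇ * e′
    primePowerTerm₀-≤ e e′ P j = ℕₚ.≤-trans (ℕₚ.≤-reflexive (Σ-cong (monics e) reorder)) evaluate
      where
      p = ⟦ P ⟧ ^ᵖ suc j
      mp : IsMonic (e′ * suc j) p
      mp = IsMonic-^ {P = ⟦ P ⟧} (⟦⟧-monic P) (suc j)
      rearrange : ∀ a b c e → a * (b * c * e) ≡ c * (a * (b * e))
      rearrange = solve-∀
      reorder : ∀ g → [ vanishesAt0 g ]ᵇ * ([ isIrreducible e′ P ∧ (p == ⟦ g ⟧) ]ᵇ * e′)
                      ≡ [ p == ⟦ g ⟧ ]ᵇ * ([ vanishesAt0 g ]ᵇ * ([ isIrreducible e′ P ]ᵇ * e′))
      reorder g = trans (cong (λ z → [ vanishesAt0 g ]ᵇ * (z * e′)) ([∧]ᵇ (isIrreducible e′ P) (p == ⟦ g ⟧)))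
                        (rearrange [ vanishesAt0 g ]ᵇ [ isIrreducible e′ P ]ᵇ [ p == ⟦ g ⟧ ]ᵇ e′)
      evaluate : Σ[ monics e ] (λ g → [ p == ⟦ g ⟧ ]ᵇ * ([ vanishesAt0 g ]ᵇ * ([ isIrreducible e′ P ]ᵇ * e′))) ≤ [ isZero (coeff ⟦ P ⟧ 0) ]ᵇ * e′
      evaluate with e′ * suc j ℕₚ.≟ e
      ... | no e′j≢e = ℕₚ.≤-trans (ℕₚ.≤-reflexive (Σmonics-none (e′ * suc j) e p mp e′j≢e _)) z≤n
      ... | yes refl = ℕₚ.≤-trans (ℕₚ.≤-reflexive (Σmonics-find (e′ * suc j) p mp _))
          (ℕₚ.≤-trans (ℕₚ.≤-reflexive (cong (λ b → [ b ]ᵇ * ([ isIrreducible e′ P ]ᵇ * e′)) (vanishesAt0-lowerCoeffs (e′ * suc j) p mp)))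
          (ℕₚ.*-mono-≤ ([isZero-coeff0-^]≤ ⟦ P ⟧ j) (ℕₚ.≤-trans (ℕₚ.*-monoˡ-≤ e′ [ isIrreducible e′ P ]ᵇ≤1) (ℕₚ.≤-reflexive (ℕₚ.*-identityˡ e′)))))

  ΣΛ₀-≤ : ∀ e → ΣΛ₀ e ≤ sumTo e (λ i → e * (q ^ i * suc i))
  ΣΛ₀-≤ e = begin
    ΣΛ₀ e
      ≡⟨ trans (Σ-comm-*ˡ (range1 e) (monics e) (λ g → [ vanishesAt0 g ]ᵇ) _)
               (Σ-cong (range1 e) (λ e′ → trans (Σ-comm-*ˡ (monics e′) (monics e) (λ g → [ vanishesAt0 g ]ᵇ) _)
                 (Σ-cong (monics e′) (λ P → Σ-comm-*ˡ (range1 e) (monics e) (λ g → [ vanishesAt0 g ]ᵇ) _)))) ⟩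
    Σ[ range1 e ] (λ e′ → Σ[ monics e′ ] (λ P → Σ[ range1 e ] (λ j → Σ[ monics e ] (λ g → [ vanishesAt0 g ]ᵇ * T e′ P j g))))
      ≤⟨ Σ-mono-≤ (range1 e) (λ e′ → Σ-mono-≤ (monics e′) (λ P →
           ℕₚ.≤-trans (ℕₚ.≤-reflexive (Σ-range1 e _)) (sumTo-mono-≤ e (λ i _ → primePowerTerm₀-≤ e e′ P i)))) ⟩
    Σ[ range1 e ] (λ e′ → Σ[ monics e′ ] (λ P → sumTo e (λ _ → [ isZero (coeff ⟦ P ⟧ 0) ]ᵇ * e′)))
      ≡⟨ Σ-cong (range1 e) (λ e′ → trans (Σ-cong (monics e′) (λ P → sumTo-const e _))
           (trans (Σ-*ˡ (monics e′) e _) (cong (e *_) (Σ-*ʳ (monics e′) e′ (λ P → [ isZero (coeff ⟦ P ⟧ 0) ]ᵇ))))) ⟩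
    Σ[ range1 e ] (λ e′ → e * (Σ[ monics e′ ] (λ P → [ isZero (coeff ⟦ P ⟧ 0) ]ᵇ) * e′))
      ≡⟨ trans (Σ-range1 e _) (sumTo-cong e (λ i _ → cong (λ z → e * (z * suc i)) (Σmonics-[coeff0≡0] i))) ⟩
    sumTo e (λ i → e * (q ^ i * suc i)) ∎
    where
    open ℕₚ.≤-Reasoning
    T : (e′ : ℕ) → Monic 𝔽 e′ → ℕ → Monic 𝔽 e → ℕ
    T e′ P j g = [ isIrreducible e′ P ∧ (⟦ P ⟧ ^ᵖ j == ⟦ g ⟧) ]ᵇ * e′

  ΣΛ₀*q≤ : ∀ e → ΣΛ₀ e * q ≤ e * e * e * q ^ e
  ΣΛ₀*q≤ e = begin
    ΣΛ₀ e * q                                  ≤⟨ ℕₚ.*-monoˡ-≤ q (ΣΛ₀-≤ e) ⟩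
    sumTo e (λ i → e * (q ^ i * suc i)) * q    ≡⟨ sumTo-*ʳ e q _ ⟨
    sumTo e (λ i → e * (q ^ i * suc i) * q)    ≤⟨ sumTo-mono-≤ e term ⟩
    sumTo e (λ _ → e * e * q ^ e)              ≡⟨ sumTo-const e _ ⟩
    e * (e * e * q ^ e)                        ≡⟨ reassoc e (q ^ e) ⟩
    e * e * e * q ^ e                          ∎
    where
    open ℕₚ.≤-Reasoning
    reorder : ∀ e x s q → e * (x * s) * q ≡ e * s * (q * x)
    reorder = solve-∀
    reassoc : ∀ e x → e * (e * e * x) ≡ e * e * e * x
    reassoc = solve-∀
    term : ∀ i → i < e → e * (q ^ i * suc i) * q ≤ e * e * q ^ e
    term i i<e = ℕₚ.≤-trans (ℕₚ.≤-reflexive (reorder e (q ^ i) (suc i) q)) (ℕₚ.*-mono-≤ (ℕₚ.*-monoʳ-≤ e i<e) (q^-mono-≤ i<e))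

  ΣΛ₀[0] : ∀ d → ΣΛ₀[ 0 ] d ≡ 0
  ΣΛ₀[0] d = trans (Σ-cong (monics d) (term d)) (Σ-0 (monics d))
    where
    term : ∀ d (f : Monic 𝔽 d) → [ vanishesAt0 f ]ᵇ * [ ⟦ f ⟧ == oneP 𝔽 ]ᵇ ≡ 0
    term zero    []ᵥ = cong (_* [ ⟦ []ᵥ ⟧ == oneP 𝔽 ]ᵇ) ([isZero]≡0 1F 1≢0)
    term (suc d) f   = trans (cong ([ vanishesAt0 f ]ᵇ *_) ([==]ᵇ≡0 ⟦ f ⟧ (oneP 𝔽) (⟦⟧≉1 d f))) (ℕₚ.*-zeroʳ [ vanishesAt0 f ]ᵇ)

  -- gr(0) = g(0) r(0), so gr vanishes at 0 only if g or r does
  Σmonics-vanishesAt0-⊗-≤ : ∀ {e d} → e ≤ d → (g : Monic 𝔽 e) (r : Monic 𝔽 (d ∸ e)) (c : ℕ) →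
    Σ[ monics d ] (λ f → [ vanishesAt0 f ]ᵇ * ([ ⟦ g ⟧ ⊗ ⟦ r ⟧ == ⟦ f ⟧ ]ᵇ * c)) ≤ ([ vanishesAt0 g ]ᵇ + [ vanishesAt0 r ]ᵇ) * c
  Σmonics-vanishesAt0-⊗-≤ {e} {d} e≤d g r c = begin
    Σ[ monics d ] (λ f → [ vanishesAt0 f ]ᵇ * ([ ⟦ g ⟧ ⊗ ⟦ r ⟧ == ⟦ f ⟧ ]ᵇ * c))
      ≡⟨ trans (Σ-cong (monics d) (λ f → swap [ vanishesAt0 f ]ᵇ [ ⟦ g ⟧ ⊗ ⟦ r ⟧ == ⟦ f ⟧ ]ᵇ c))
               (Σmonics-find d (⟦ g ⟧ ⊗ ⟦ r ⟧) mgr (λ f → [ vanishesAt0 f ]ᵇ * c)) ⟩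
    [ vanishesAt0 (lowerCoeffs d (⟦ g ⟧ ⊗ ⟦ r ⟧)) ]ᵇ * c
      ≡⟨ cong (λ b → [ b ]ᵇ * c) (trans (vanishesAt0-lowerCoeffs d (⟦ g ⟧ ⊗ ⟦ r ⟧) mgr) (cong isZero (coeff0-⊗ ⟦ g ⟧ ⟦ r ⟧))) ⟩
    [ isZero (coeff ⟦ g ⟧ 0 *ᶠ coeff ⟦ r ⟧ 0) ]ᵇ * c
      ≤⟨ ℕₚ.*-monoˡ-≤ c ([isZero-*]≤ _ _) ⟩
    ([ isZero (coeff ⟦ g ⟧ 0) ]ᵇ + [ isZero (coeff ⟦ r ⟧ 0) ]ᵇ) * c
      ≡⟨ cong₂ (λ a b → (a + b) * c) (cong [_]ᵇ (sym (vanishesAt0-coeff0 g))) (cong [_]ᵇ (sym (vanishesAt0-coeff0 r))) ⟩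
    ([ vanishesAt0 g ]ᵇ + [ vanishesAt0 r ]ᵇ) * c ∎
    where
    open ℕₚ.≤-Reasoning
    mgr = IsMonic-⟦⟧⊗⟦⟧ e≤d g r
    swap : ∀ a b c → a * (b * c) ≡ b * (a * c)
    swap = solve-∀

  ΣΛ₀[suc]-≤ : ∀ k d → ΣΛ₀[ suc k ] d ≤ Σ[ range0 d ] (λ e → ΣΛ₀ e * ΣΛ[ k ] (d ∸ e) + ΣΛ e * ΣΛ₀[ k ] (d ∸ e))
  ΣΛ₀[suc]-≤ k d = begin
    ΣΛ₀[ suc k ] d
      ≡⟨ trans (Σ-comm-*ˡ (range0 d) (monics d) (λ f → [ vanishesAt0 f ]ᵇ) _)
               (Σ-cong (range0 d) (λ e → trans (Σ-comm-*ˡ (monics e) (monics d) (λ f → [ vanishesAt0 f ]ᵇ) _)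
                 (Σ-cong (monics e) (λ g → Σ-comm-*ˡ (monics (d ∸ e)) (monics d) (λ f → [ vanishesAt0 f ]ᵇ) _)))) ⟩
    Σ[ range0 d ] (λ e → Σ[ monics e ] (λ g → Σ[ monics (d ∸ e) ] (λ r → Σ[ monics d ] (λ f → [ vanishesAt0 f ]ᵇ * T e g r f))))
      ≡⟨ Σ-range0 d _ ⟩
    sumTo (suc d) (λ e → Σ[ monics e ] (λ g → Σ[ monics (d ∸ e) ] (λ r → Σ[ monics d ] (λ f → [ vanishesAt0 f ]ᵇ * T e g r f))))
      ≤⟨ sumTo-mono-≤ (suc d) (λ e e<1+d → degree-e e (ℕₚ.≤-pred e<1+d)) ⟩
    sumTo (suc d) (λ e → ΣΛ₀ e * ΣΛ[ k ] (d ∸ e) + ΣΛ e * ΣΛ₀[ k ] (d ∸ e))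
      ≡⟨ Σ-range0 d _ ⟨
    Σ[ range0 d ] (λ e → ΣΛ₀ e * ΣΛ[ k ] (d ∸ e) + ΣΛ e * ΣΛ₀[ k ] (d ∸ e)) ∎
    where
    open ℕₚ.≤-Reasoning
    T : (e : ℕ) → Monic 𝔽 e → Monic 𝔽 (d ∸ e) → Monic 𝔽 d → ℕ
    T e g r f = [ ⟦ g ⟧ ⊗ ⟦ r ⟧ == ⟦ f ⟧ ]ᵇ * (Λ 𝔽 e g * Λ[_] 𝔽 k (d ∸ e) r)
    distrib : ∀ a b x y → (a + b) * (x * y) ≡ a * x * y + x * (b * y)
    distrib = solve-∀
    degree-e : ∀ e → e ≤ d → Σ[ monics e ] (λ g → Σ[ monics (d ∸ e) ] (λ r → Σ[ monics d ] (λ f → [ vanishesAt0 f ]ᵇ * T e g r f)))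
                             ≤ ΣΛ₀ e * ΣΛ[ k ] (d ∸ e) + ΣΛ e * ΣΛ₀[ k ] (d ∸ e)
    degree-e e e≤d = ℕₚ.≤-trans (Σ-mono-≤ (monics e) (λ g → Σ-mono-≤ (monics (d ∸ e)) (λ r →
         ℕₚ.≤-trans (Σmonics-vanishesAt0-⊗-≤ e≤d g r _)
                    (ℕₚ.≤-reflexive (distrib [ vanishesAt0 g ]ᵇ [ vanishesAt0 r ]ᵇ (Λ 𝔽 e g) (Λ[_] 𝔽 k (d ∸ e) r))))))
       (ℕₚ.≤-reflexive (trans (Σ-cong (monics e) (λ g → Σ-+ (monics (d ∸ e)) _ _)) (trans (Σ-+ (monics e) _ _) (cong₂ _+_
          (trans (Σ-cong (monics e) (λ g → Σ-*ˡ (monics (d ∸ e)) ([ vanishesAt0 g ]ᵇ * Λ 𝔽 e g) _)) (Σ-*ʳ (monics e) (ΣΛ[ k ] (d ∸ e)) _))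
          (trans (Σ-cong (monics e) (λ g → Σ-*ˡ (monics (d ∸ e)) (Λ 𝔽 e g) _)) (Σ-*ʳ (monics e) (ΣΛ₀[ k ] (d ∸ e)) _))))))

  ΣΛ₀[]*q≤ : ∀ k N d → d ≤ N → ΣΛ₀[ k ] d * q ≤ errorConstant k N * q ^ d
  ΣΛ₀[]*q≤ zero    N d _   = ℕₚ.≤-trans (ℕₚ.≤-reflexive (cong (_* q) (ΣΛ₀[0] d))) z≤n
  ΣΛ₀[]*q≤ (suc k) N d d≤N = begin
    ΣΛ₀[ suc k ] d * q
      ≤⟨ ℕₚ.*-monoˡ-≤ q (ΣΛ₀[suc]-≤ k d) ⟩
    Σ[ range0 d ] (λ e → ΣΛ₀ e * ΣΛ[ k ] (d ∸ e) + ΣΛ e * ΣΛ₀[ k ] (d ∸ e)) * q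
      ≡⟨ Σ-*ʳ (range0 d) q (λ e → ΣΛ₀ e * ΣΛ[ k ] (d ∸ e) + ΣΛ e * ΣΛ₀[ k ] (d ∸ e)) ⟨
    Σ[ range0 d ] (λ e → (ΣΛ₀ e * ΣΛ[ k ] (d ∸ e) + ΣΛ e * ΣΛ₀[ k ] (d ∸ e)) * q)
      ≡⟨ trans (Σ-cong (range0 d) (λ e → distrib (ΣΛ₀ e) (ΣΛ[ k ] (d ∸ e)) (ΣΛ e) (ΣΛ₀[ k ] (d ∸ e)) q))
               (Σ-+ (range0 d) (λ e → (ΣΛ₀ e * q) * ΣΛ[ k ] (d ∸ e)) (λ e → ΣΛ e * (ΣΛ₀[ k ] (d ∸ e) * q))) ⟩
    Σ[ range0 d ] (λ e → (ΣΛ₀ e * q) * ΣΛ[ k ] (d ∸ e)) + Σ[ range0 d ] (λ e → ΣΛ e * (ΣΛ₀[ k ] (d ∸ e) * q))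
      ≤⟨ ℕₚ.+-mono-≤
           (convolution-≤ d (λ e → ΣΛ₀ e * q) ΣΛ[ k ] (N * N * N) (suc N ^ k)
              (λ e e≤d → ℕₚ.≤-trans (ΣΛ₀*q≤ e) (ℕₚ.*-monoˡ-≤ (q ^ e) (cube-mono (ℕₚ.≤-trans e≤d d≤N))))
              (λ m m≤d → ΣΛ[]≤ k N m (ℕₚ.≤-trans m≤d d≤N)))
           (convolution-≤ d ΣΛ (λ m → ΣΛ₀[ k ] m * q) 1 (errorConstant k N)
              (λ e _ → ΣΛ≤q^ e) (λ m m≤d → ΣΛ₀[]*q≤ k N m (ℕₚ.≤-trans m≤d d≤N))) ⟩
    suc d * (N * N * N * suc N ^ k) * q ^ d + suc d * (1 * errorConstant k N) * q ^ d
      ≤⟨ ℕₚ.+-mono-≤ (ℕₚ.*-monoˡ-≤ (q ^ d) (ℕₚ.*-monoˡ-≤ (N * N * N * suc N ^ k) (s≤s d≤N)))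
                     (ℕₚ.*-monoˡ-≤ (q ^ d) (ℕₚ.*-mono-≤ (s≤s d≤N) (ℕₚ.≤-reflexive (ℕₚ.*-identityˡ (errorConstant k N))))) ⟩
    suc N * (N * N * N * suc N ^ k) * q ^ d + suc N * errorConstant k N * q ^ d
      ≡⟨ ℕₚ.*-distribʳ-+ (q ^ d) (suc N * (N * N * N * suc N ^ k)) (suc N * errorConstant k N) ⟨
    errorConstant (suc k) N * q ^ d ∎
    where
    open ℕₚ.≤-Reasoning
    distrib : ∀ a b c z q → (a * b + c * z) * q ≡ a * q * b + c * (z * q)
    distrib = solve-∀
    cube-mono : ∀ {e} → e ≤ N → e * e * e ≤ N * N * N
    cube-mono e≤N = ℕₚ.*-mono-≤ (ℕₚ.*-mono-≤ e≤N e≤N) e≤N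

  SΛ+ΣΛ₀[]≡ΣΛ[] : ∀ k n → SΛ 𝔽 k n + ΣΛ₀[ k ] n ≡ ΣΛ[ k ] n
  SΛ+ΣΛ₀[]≡ΣΛ[] k n = trans (sym (Σ-+ (monics n) _ _)) (Σ-cong (monics n) (λ f → split (vanishesAt0 f) (Λ[_] 𝔽 k n f)))
    where
    split : ∀ b x → [ not b ]ᵇ * x + [ b ]ᵇ * x ≡ x
    split true  x = ℕₚ.+-identityʳ x
    split false x = trans (ℕₚ.+-identityʳ (x + 0)) (ℕₚ.+-identityʳ x)

  mainTerm≡ : ∀ h k n → q ^ (h + 1) * ((suc n ∸ 1) C (suc k ∸ 1)) * q ^ suc n
                        ≡ q ^ (h + 1) * SΛ 𝔽 (suc k) (suc n) + q ^ h * (ΣΛ₀[ suc k ] (suc n) * q)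
  mainTerm≡ h k n = begin
    q ^ (h + 1) * (n C k) * q ^ suc n                                   ≡⟨ ℕₚ.*-assoc (q ^ (h + 1)) (n C k) (q ^ suc n) ⟩
    q ^ (h + 1) * ((n C k) * q ^ suc n)                                 ≡⟨ cong (q ^ (h + 1) *_) (ΣΛ[suc]≡C k (suc n)) ⟨
    q ^ (h + 1) * ΣΛ[ suc k ] (suc n)                                   ≡⟨ cong (q ^ (h + 1) *_) (SΛ+ΣΛ₀[]≡ΣΛ[] (suc k) (suc n)) ⟨
    q ^ (h + 1) * (SΛ 𝔽 (suc k) (suc n) + ΣΛ₀[ suc k ] (suc n))         ≡⟨ ℕₚ.*-distribˡ-+ (q ^ (h + 1)) _ _ ⟩
    q ^ (h + 1) * SΛ 𝔽 (suc k) (suc n) + q ^ (h + 1) * ΣΛ₀[ suc k ] (suc n)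
      ≡⟨ cong (q ^ (h + 1) * SΛ 𝔽 (suc k) (suc n) +_) (trans (cong (_* ΣΛ₀[ suc k ] (suc n)) (ℕₚ.^-distribˡ-+-* q h 1)) (reorder (q ^ h) q _)) ⟩
    q ^ (h + 1) * SΛ 𝔽 (suc k) (suc n) + q ^ h * (ΣΛ₀[ suc k ] (suc n) * q) ∎
    where
    open ≡-Reasoning
    reorder : ∀ x q z → x * (q * 1) * z ≡ x * (z * q)
    reorder = solve-∀

  errorTerm-≤ : ∀ h k n → q ^ h * (ΣΛ₀[ k ] n * q) ≤ errorConstant k n * q ^ h * q ^ n
  errorTerm-≤ h k n = ℕₚ.≤-trans (ℕₚ.*-monoʳ-≤ (q ^ h) (ΣΛ₀[]*q≤ k n n ℕₚ.≤-refl)) (ℕₚ.≤-reflexive (reorder (q ^ h) (errorConstant k n) (q ^ n)))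
    where
    reorder : ∀ x y z → x * (y * z) ≡ y * x * z
    reorder = solve-∀

open import Data.Integer using (+_; _-_; ∣_∣)
import Data.Integer.Properties as ℤₚ

∣a-[a+b]∣≡b : ∀ a b → ∣ (+ a) - (+ (a + b)) ∣ ≡ b
∣a-[a+b]∣≡b a b = trans (cong ∣_∣ (ℤₚ.m-n≡m⊖n a (a + b))) (trans (ℤₚ.∣⊖∣-≤ (ℕₚ.m≤m+n a b)) (ℕₚ.m+n∸m≡n a b))

lemma7p2 : (n h k : ℕ) → 2 ≤ n → h ≤ n ∸ 2 → 1 ≤ k →
    ((𝔽 : FiniteField) →
      total𝓝U 𝔽 k n h ≡ FiniteField.q 𝔽 ^ (h + 1) * SΛ 𝔽 k n)
    × (Σ[ K ∈ ℕ ] Σ[ q₀ ∈ ℕ ] ((𝔽 : FiniteField) → q₀ ≤ FiniteField.q 𝔽 →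
        ∣ (+ total𝓝U 𝔽 k n h)
          - (+ (FiniteField.q 𝔽 ^ (h + 1) * ((n ∸ 1) C (k ∸ 1)) * FiniteField.q 𝔽 ^ n)) ∣
        ≤ K * FiniteField.q 𝔽 ^ h * FiniteField.q 𝔽 ^ n))
lemma7p2 n@(suc n′) h k@(suc k′) 2≤n h≤n∸2 _ = exact , errorConstant k n , 0 , error-≤
  where
  1+h<n : suc h < n
  1+h<n = ℕₚ.≤-trans (s≤s (s≤s h≤n∸2)) (ℕₚ.≤-reflexive (ℕₚ.m+[n∸m]≡n 2≤n))
  exact : (𝔽 : FiniteField) → total𝓝U 𝔽 k n h ≡ FiniteField.q 𝔽 ^ (h + 1) * SΛ 𝔽 k n
  exact 𝔽 = trans (OverFiniteField.total𝓝U≡q^[h+1]*SΛ 𝔽 k n h 1+h<n)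
                  (cong (λ e → FiniteField.q 𝔽 ^ e * SΛ 𝔽 k n) (ℕₚ.+-comm 1 h))
  error-≤ : (𝔽 : FiniteField) → 0 ≤ FiniteField.q 𝔽 →
    ∣ (+ total𝓝U 𝔽 k n h) - (+ (FiniteField.q 𝔽 ^ (h + 1) * ((n ∸ 1) C (k ∸ 1)) * FiniteField.q 𝔽 ^ n)) ∣
      ≤ errorConstant k n * FiniteField.q 𝔽 ^ h * FiniteField.q 𝔽 ^ n
  error-≤ 𝔽 _ = begin
    ∣ (+ total𝓝U 𝔽 k n h) - (+ (q ^ (h + 1) * ((n ∸ 1) C (k ∸ 1)) * q ^ n)) ∣
      ≡⟨ cong₂ (λ a b → ∣ (+ a) - (+ b) ∣) (exact 𝔽) (mainTerm≡ h k′ n′) ⟩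
    ∣ (+ (q ^ (h + 1) * SΛ 𝔽 k n)) - (+ (q ^ (h + 1) * SΛ 𝔽 k n + q ^ h * (ΣΛ₀[ k ] n * q))) ∣
      ≡⟨ ∣a-[a+b]∣≡b (q ^ (h + 1) * SΛ 𝔽 k n) _ ⟩
    q ^ h * (ΣΛ₀[ k ] n * q)
      ≤⟨ errorTerm-≤ h k n ⟩
    errorConstant k n * q ^ h * q ^ n ∎
    where
    open FiniteField 𝔽 using (q)
    open ErrorTerm 𝔽
    open ℕₚ.≤-Reasoning
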